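{- Let $k>5$ be an integer, $w_k=\Big(\prod_{i=2}^{k-1}{\tt a}{\tt b}^i{\tt a}{\tt a}\cdot{\tt a}{\tt b}^i{\tt a}{\tt b}{\tt a}^{i-2}\Big)\cdot{\tt a}{\tt b}^k{\tt a}$, and write $\beta(x)=\beta(x,w_k{\tt a})$. Then $\beta({\tt a}^i{\tt b})={\tt b}{\tt a}^{k-i-2}$ for all $4\le i\le k-2$; $\beta({\tt a}^3{\tt b})={\tt b}{\tt b}^5({\tt a}{\tt b})^{k-6}{\tt a}$; $\beta({\tt a}^2{\tt b})={\tt a}{\tt a}{\tt a}{\tt b}{\tt a}^{2k-8}$; $\beta({\tt a}{\tt b})={\tt b}^{k-2}{\tt a}{\tt a}{\tt b}{\tt a}^{2k-6}$; $\beta({\tt b}{\tt a})={\tt a}^{k-5}{\tt b}{\tt b}{\tt b}{\tt b}{\tt a}{\tt b}^{k-5}{\tt a}{\tt b}^{k-2}{\tt a}$; $\beta({\tt b}^j{\tt a})={\tt b}{\tt a}{\tt b}^{2k-2j-2}{\tt a}$ for all $2\le j\le k-1$; and $\beta({\tt b}^k{\tt a})={\tt a}$. Hence $\mathrm{BWT}(w_k{\tt a})=\prod_{i=2}^{k-1}\beta({\tt a}^{k-i}{\tt b})\cdot\prod_{i=1}^{k}\beta({\tt b}^i{\tt a})$, and $r(w_k{\tt a})=8k-20$.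
   Context: Alphabet $\{{\tt a},{\tt b}\}$ with ${\tt a}<{\tt b}$; $\prod$ is concatenation in increasing index order. For a word $w$ of length $n$, $\mathrm{BWT}(w)$ is obtained by sorting the conjugates $w[i..n-1]w[0..i-1]$ lexicographically and concatenating their last characters; $r(w)$ is the number of maximal equal-letter runs of $\mathrm{BWT}(w)$. For words $x,w$, $\beta(x,w)$ is the factor of $\mathrm{BWT}(w)$ formed by the last characters of the conjugates of $w$ having $x$ as a prefix (a contiguous range in sorted order). -}

module Defs where

open import Data.Nat using (ℕ; zero; suc; _+_; _∸_)
open import Data.Bool using (Bool; true; false; _∧_; if_then_else_)
open import Data.List using (List; []; _∷_; _++_; map; concat; replicate; drop; take; length; upTo; filter)
open import Relation.Binary.PropositionalEquality using (_≡_)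

data Letter : Set where
  a b : Letter

Word : Set
Word = List Letter

_<L_ : Letter → Letter → Bool
a <L b = true
_ <L _ = false

_=L_ : Letter → Letter → Bool
a =L a = true
b =L b = true
_ =L _ = false

lexLeq : Word → Word → Bool
lexLeq [] _ = true
lexLeq (_ ∷ _) [] = false
lexLeq (x ∷ xs) (y ∷ ys) = if x <L y then true else (if x =L y then lexLeq xs ys else false)

insert : Word → List Word → List Word
insert u [] = u ∷ []
insert u (v ∷ vs) = if lexLeq u v then u ∷ v ∷ vs else v ∷ insert u vs

sortWords : List Word → List Word
sortWords [] = []
sortWords (u ∷ us) = insert u (sortWords us)

conj : Word → ℕ → Word
conj w i = drop i w ++ take i w

conjugates : Word → List Word
conjugates w = map (conj w) (upTo (length w))

sortedConjugates : Word → List Word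
sortedConjugates w = sortWords (conjugates w)

-- last character of a word (only applied to nonempty words; default a for [])
lastL : Word → Letter
lastL [] = a
lastL (x ∷ []) = x
lastL (_ ∷ y ∷ ys) = lastL (y ∷ ys)

BWT : Word → Word
BWT w = map lastL (sortedConjugates w)

isPrefix : Word → Word → Bool
isPrefix [] _ = true
isPrefix (_ ∷ _) [] = false
isPrefix (x ∷ xs) (y ∷ ys) = (x =L y) ∧ isPrefix xs ys

β : Word → Word → Word
β x w = map lastL (filter (λ u → isPrefix x u ≟B true) (sortedConjugates w))
  where
  open import Data.Bool.Properties using () renaming (_≟_ to _≟B_)

runsFrom : Letter → Word → ℕ
runsFrom _ [] = 0
runsFrom p (x ∷ xs) = (if p =L x then 0 else 1) + runsFrom x xs

runs : Word → ℕ
runs [] = 0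
runs (x ∷ xs) = suc (runsFrom x xs)

r : Word → ℕ
r w = runs (BWT w)

_^_ : Word → ℕ → Word
x ^ n = concat (replicate n x)

-- ∏_{i=lo}^{hi} f i  (concatenation in increasing i; empty if hi < lo)
prod : ℕ → ℕ → (ℕ → Word) → Word
prod lo hi f = concat (map (λ j → f (lo + j)) (upTo (suc hi ∸ lo)))

wk : ℕ → Word
wk k = prod 2 (k ∸ 1) (λ i → (a ∷ []) ++ ((b ∷ []) ^ i) ++ (a ∷ a ∷ [])
                             ++ (a ∷ []) ++ ((b ∷ []) ^ i) ++ (a ∷ b ∷ []) ++ ((a ∷ []) ^ (i ∸ 2)))
       ++ (a ∷ []) ++ ((b ∷ []) ^ k) ++ (a ∷ [])

W : ℕ → Word
W k = wk k ++ (a ∷ [])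

-- The keys a^e b (e = k-2, ..., 1) and b^m a (m = 1, ..., k) are listed in increasing order,
-- any two of them first differ in an a against a b, and every conjugate of w = w_k a begins
-- with one of them.  So sorting the conjugates means sorting each key class separately, and
-- BWT(w) is the concatenation of the β's.  Moving the leading a to the end, w is conjugate to
-- V = D_2 ... D_(k-1) b^k a^3 with D_i = b^i a^3 b^i a b a^(i-1).  A conjugate starting e
-- letters before the end of a maximal run c^l (e ≤ l) begins with the key c^e c̄ (c̄ the other
-- letter), so each class can be read off run by run.  Within a class the members are sorted by
-- the words that follow the key, and their last letters are immediate.
module Submission where

open import Defs
open import Data.Nat using (ℕ; _≤_; _<_; _+_; _*_; _∸_)
open import Data.List using (List; []; _∷_; _++_)
open import Data.Product using (_×_)
open import Relation.Binary.PropositionalEquality using (_≡_)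
open import Data.Nat using (zero; suc; z≤n; s≤s; _≤ᵇ_; _≟_; _≤?_)
open import Data.Nat.Properties using (+-suc; +-identityʳ; ≤-refl; ≤-trans; n∸n≡0; +-∸-assoc; ≤∧≢⇒<; ≤-pred; m+n∸m≡n; +-assoc; m+[n∸m]≡n; *-distribˡ-+; ∸-+-assoc; +-comm; m≤m+n; m≤n⇒m≤1+n; ≤⇒≤ᵇ; ≤ᵇ⇒≤; ≰⇒>; m∸n≡0⇒m≤n; ≤-antisym; m+n∸n≡m; ∸-monoʳ-<; m∸[m∸n]≡n; m∸n≤m; m<n⇒0<n∸m; ∸-monoʳ-≤; <⇒≤; <-irrefl; ≤-reflexive; +-monoˡ-≤; n≤1+n; m≤n⇒∃[o]m+o≡n)
open import Data.Nat.Tactic.RingSolver using (solve-∀)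
open import Data.Bool using (true; false; if_then_else_) renaming (T to IsT)
open import Data.Bool.Properties using () renaming (_≟_ to _≟B_)
open import Data.List using (map; concat; replicate; drop; take; length; upTo; filter; applyUpTo)
open import Data.List.Properties using (++-assoc; ++-identityʳ; filter-++; filter-accept; filter-reject; map-upTo; length-++; length-replicate; map-++; concat-map; map-∘; map-cong; concat-++)
open import Data.List.Relation.Unary.All as All using (All; []; _∷_)
open import Data.List.Relation.Unary.All.Properties as AllP using ()
open import Data.List.Relation.Unary.Any as Any using (Any; here; there)
open import Data.List.Relation.Unary.Any.Properties as AnyP using ()
open import Data.List.Relation.Unary.AllPairs as AP using (AllPairs; []; _∷_)
open import Data.List.Relation.Unary.AllPairs.Properties as APP using ()
import Data.List.Relation.Binary.Permutation.Propositional as Pm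
open import Data.List.Relation.Binary.Permutation.Propositional using (_↭_; ↭-refl; ↭-prep; ↭-swap; ↭-trans; ↭-sym; ↭-reflexive)
open import Data.List.Relation.Binary.Permutation.Propositional.Properties using (All-resp-↭; ∈-resp-↭; drop-∷; ↭-empty-inv; ++⁺ˡ; ++⁺ʳ; ++⁺; shift; ++-comm; filter-↭; shifts)
open import Data.Product using (Σ; _,_; proj₁; proj₂)
open import Data.Empty using (⊥; ⊥-elim)
open import Relation.Nullary using (¬_; Dec; yes; no)
open import Relation.Binary.PropositionalEquality using (refl; sym; trans; cong; cong₂; subst; subst₂; module ≡-Reasoning)
open import Function using (_∘_)


Lex≤ : Word → Word → Set
Lex≤ u v = lexLeq u v ≡ true

lex-trans : ∀ u v w → Lex≤ u v → Lex≤ v w → Lex≤ u w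
lex-trans [] v w p q = refl
lex-trans (x ∷ u) [] w () q
lex-trans (x ∷ u) (y ∷ v) [] p ()
lex-trans (a ∷ u) (a ∷ v) (a ∷ w) p q = lex-trans u v w p q
lex-trans (a ∷ u) (a ∷ v) (b ∷ w) p q = refl
lex-trans (a ∷ u) (b ∷ v) (a ∷ w) p ()
lex-trans (a ∷ u) (b ∷ v) (b ∷ w) p q = refl
lex-trans (b ∷ u) (a ∷ v) w () q
lex-trans (b ∷ u) (b ∷ v) (a ∷ w) p ()
lex-trans (b ∷ u) (b ∷ v) (b ∷ w) p q = lex-trans u v w p q

lex-antisym : ∀ u v → Lex≤ u v → Lex≤ v u → u ≡ v
lex-antisym [] [] p q = refl
lex-antisym [] (x ∷ v) p ()
lex-antisym (x ∷ u) [] () q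
lex-antisym (a ∷ u) (a ∷ v) p q = cong (a ∷_) (lex-antisym u v p q)
lex-antisym (a ∷ u) (b ∷ v) p ()
lex-antisym (b ∷ u) (a ∷ v) () q
lex-antisym (b ∷ u) (b ∷ v) p q = cong (b ∷_) (lex-antisym u v p q)

lex-total : ∀ u v → lexLeq u v ≡ false → Lex≤ v u
lex-total [] v ()
lex-total (x ∷ u) [] p = refl
lex-total (a ∷ u) (a ∷ v) p = lex-total u v p
lex-total (a ∷ u) (b ∷ v) ()
lex-total (b ∷ u) (a ∷ v) p = refl
lex-total (b ∷ u) (b ∷ v) p = lex-total u v p


run : ℕ → Letter → Word
run n c = replicate n c

[c]^n≡run : ∀ n c → (c ∷ []) ^ n ≡ run n c
[c]^n≡run zero c = refl
[c]^n≡run (suc n) c = cong (c ∷_) ([c]^n≡run n c)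

run-++ : ∀ p q c → run p c ++ run q c ≡ run (p + q) c
run-++ zero q c = refl
run-++ (suc p) q c = cong (c ∷_) (run-++ p q c)

run-∷ʳ : ∀ n c → run (suc n) c ≡ run n c ++ c ∷ []
run-∷ʳ zero c = refl
run-∷ʳ (suc n) c = cong (c ∷_) (run-∷ʳ n c)

-- Unlike the strict lexicographic order, ≺ never relates a word to one of its extensions.
data _≺_ : Word → Word → Set where
  ≺-here : ∀ {p q} → (a ∷ p) ≺ (b ∷ q)
  ≺-there : ∀ {x p q} → p ≺ q → (x ∷ p) ≺ (x ∷ q)

≺⇒Lex≤ : ∀ {p q} → p ≺ q → Lex≤ p q
≺⇒Lex≤ ≺-here = refl
≺⇒Lex≤ (≺-there {a} r) = ≺⇒Lex≤ r
≺⇒Lex≤ (≺-there {b} r) = ≺⇒Lex≤ r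

≺-trans : ∀ {p q r} → p ≺ q → q ≺ r → p ≺ r
≺-trans ≺-here (≺-there h2) = ≺-here
≺-trans (≺-there h1) ≺-here = ≺-here
≺-trans (≺-there h1) (≺-there h2) = ≺-there (≺-trans h1 h2)

≺-++ : ∀ {p q} r s → p ≺ q → (p ++ r) ≺ (q ++ s)
≺-++ r s ≺-here = ≺-here
≺-++ r s (≺-there h) = ≺-there (≺-++ r s h)

++-≺ : ∀ c {p q} → p ≺ q → (c ++ p) ≺ (c ++ q)
++-≺ [] h = h
++-≺ (x ∷ c) h = ≺-there (++-≺ c h)

bᵐa≺bⁿ : ∀ m n {p q} → m < n → (run m b ++ a ∷ p) ≺ (run n b ++ q)
bᵐa≺bⁿ zero (suc n) (s≤s z≤n) = ≺-here
bᵐa≺bⁿ (suc m) (suc n) (s≤s h) = ≺-there (bᵐa≺bⁿ m n h)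

aᵐ≺aⁿb : ∀ m n {p q} → n < m → (run m a ++ p) ≺ (run n a ++ b ∷ q)
aᵐ≺aⁿb (suc m) zero (s≤s z≤n) = ≺-here
aᵐ≺aⁿb (suc m) (suc n) (s≤s h) = ≺-there (aᵐ≺aⁿb m n h)

adjacent⇒monotone : ∀ (κ : ℕ → Word) N → (∀ r → suc r < N → κ r ≺ κ (suc r)) → ∀ {r s} → r < s → s < N → κ r ≺ κ s
adjacent⇒monotone κ N adj {r} {suc s} (s≤s r≤s) sN with r ≟ s
... | yes refl = adj r sN
... | no ne = ≺-trans (adjacent⇒monotone κ N adj (≤∧≢⇒< r≤s ne) (<⇒≤ sN)) (adj s sN)


HasPrefix : Word → Word → Set
HasPrefix K u = Σ Word (λ r → u ≡ K ++ r)

HasPrefix-[] : ∀ w → HasPrefix [] w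
HasPrefix-[] w = w , refl

HasPrefix-∷ : ∀ x {K u} → HasPrefix K u → HasPrefix (x ∷ K) (x ∷ u)
HasPrefix-∷ x (r , e) = r , cong (x ∷_) e

HasPrefix-++ : ∀ c {K u} → HasPrefix K u → HasPrefix (c ++ K) (c ++ u)
HasPrefix-++ c {K} (r , e) = r , trans (cong (c ++_) e) (sym (++-assoc c K r))

HasPrefix-extend : ∀ {K u} v → HasPrefix K u → HasPrefix K (u ++ v)
HasPrefix-extend {K} v (r , e) = r ++ v , trans (cong (_++ v) e) (++-assoc K r v)

HasPrefix-truncate : ∀ K M {u} → HasPrefix (K ++ M) u → HasPrefix K u
HasPrefix-truncate K M (r , e) = M ++ r , trans e (++-assoc K M r)

HasPrefix-shorten : ∀ c p q {u} → HasPrefix (c ++ (p ++ q)) u → HasPrefix (c ++ p) u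
HasPrefix-shorten c p q h = HasPrefix-truncate (c ++ p) q (subst (λ z → HasPrefix z _) (sym (++-assoc c p q)) h)

HasPrefix-≺ : ∀ {K K' u v} → K ≺ K' → HasPrefix K u → HasPrefix K' v → u ≺ v
HasPrefix-≺ h (r , refl) (s , refl) = ≺-++ r s h

=L-refl : ∀ x → (x =L x) ≡ true
=L-refl a = refl
=L-refl b = refl

isPrefix-++ : ∀ K r → isPrefix K (K ++ r) ≡ true
isPrefix-++ [] r = refl
isPrefix-++ (x ∷ K) r rewrite =L-refl x = isPrefix-++ K r

isPrefix⇒HasPrefix : ∀ K u → isPrefix K u ≡ true → HasPrefix K u
isPrefix⇒HasPrefix [] u p = u , refl
isPrefix⇒HasPrefix (x ∷ K) [] ()
isPrefix⇒HasPrefix (a ∷ K) (a ∷ u) p with isPrefix⇒HasPrefix K u p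
... | r , e = r , cong (a ∷_) e
isPrefix⇒HasPrefix (a ∷ K) (b ∷ u) ()
isPrefix⇒HasPrefix (b ∷ K) (a ∷ u) ()
isPrefix⇒HasPrefix (b ∷ K) (b ∷ u) p with isPrefix⇒HasPrefix K u p
... | r , e = r , cong (b ∷_) e

≺⇒¬prefixʳ : ∀ {x y} u → x ≺ y → isPrefix x u ≡ true → isPrefix y u ≡ false
≺⇒¬prefixʳ [] ≺-here ()
≺⇒¬prefixʳ (a ∷ u) ≺-here p = refl
≺⇒¬prefixʳ (b ∷ u) ≺-here ()
≺⇒¬prefixʳ [] (≺-there h) ()
≺⇒¬prefixʳ {a ∷ _} (a ∷ u) (≺-there h) p = ≺⇒¬prefixʳ u h p
≺⇒¬prefixʳ {a ∷ _} (b ∷ u) (≺-there h) ()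
≺⇒¬prefixʳ {b ∷ _} (a ∷ u) (≺-there h) ()
≺⇒¬prefixʳ {b ∷ _} (b ∷ u) (≺-there h) p = ≺⇒¬prefixʳ u h p

≺⇒¬prefixˡ : ∀ {x y} u → x ≺ y → isPrefix y u ≡ true → isPrefix x u ≡ false
≺⇒¬prefixˡ [] ≺-here ()
≺⇒¬prefixˡ (a ∷ u) ≺-here ()
≺⇒¬prefixˡ (b ∷ u) ≺-here p = refl
≺⇒¬prefixˡ [] (≺-there h) ()
≺⇒¬prefixˡ {a ∷ _} (a ∷ u) (≺-there h) p = ≺⇒¬prefixˡ u h p
≺⇒¬prefixˡ {a ∷ _} (b ∷ u) (≺-there h) ()
≺⇒¬prefixˡ {b ∷ _} (a ∷ u) (≺-there h) ()
≺⇒¬prefixˡ {b ∷ _} (b ∷ u) (≺-there h) p = ≺⇒¬prefixˡ u h p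


Sorted : List Word → Set
Sorted = AllPairs Lex≤

insert-↭ : ∀ u S → insert u S ↭ u ∷ S
insert-↭ u [] = ↭-refl
insert-↭ u (v ∷ vs) with lexLeq u v
... | true = ↭-refl
... | false = ↭-trans (↭-prep v (insert-↭ u vs)) (↭-swap v u ↭-refl)

sortWords-↭ : ∀ L → sortWords L ↭ L
sortWords-↭ [] = ↭-refl
sortWords-↭ (u ∷ L) = ↭-trans (insert-↭ u (sortWords L)) (↭-prep u (sortWords-↭ L))

insert-sorted : ∀ u S → Sorted S → Sorted (insert u S)
insert-sorted u [] s = [] ∷ []
insert-sorted u (v ∷ vs) (pv ∷ s) with lexLeq u v in eq
... | true = (eq ∷ All.map (λ {w} q → lex-trans u v w eq q) pv) ∷ pv ∷ s
... | false = All-resp-↭ (↭-sym (insert-↭ u vs)) (lex-total u v eq ∷ pv) ∷ insert-sorted u vs s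

sortWords-sorted : ∀ L → Sorted (sortWords L)
sortWords-sorted [] = []
sortWords-sorted (u ∷ L) = insert-sorted u (sortWords L) (sortWords-sorted L)

sorted-↭⇒≡ : ∀ {S T} → Sorted S → Sorted T → S ↭ T → S ≡ T
sorted-↭⇒≡ {[]} {T} s t p = sym (↭-empty-inv (↭-sym p))
sorted-↭⇒≡ {x ∷ xs} {[]} s t p with ↭-empty-inv p
... | ()
sorted-↭⇒≡ {x ∷ xs} {y ∷ ys} (px ∷ s) (py ∷ t) p = goal
  where
  xy : x ≡ y
  xy with ∈-resp-↭ (↭-sym p) (here refl) | ∈-resp-↭ p (here refl)
  ... | here e | _ = sym e
  ... | there _ | here e = e
  ... | there m1 | there m2 = lex-antisym x y (All.lookup px m1) (All.lookup py m2)
  goal : x ∷ xs ≡ y ∷ ys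
  goal rewrite xy = cong (y ∷_) (sorted-↭⇒≡ s t (drop-∷ (subst (λ z → z ∷ xs ↭ y ∷ ys) xy p)))

AllPairs≺⇒Sorted : ∀ {L} → AllPairs _≺_ L → Sorted L
AllPairs≺⇒Sorted = AP.map ≺⇒Lex≤

AllPairs-single : ∀ {A : Set} {R : A → A → Set} (x : A) → AllPairs R (x ∷ [])
AllPairs-single x = [] ∷ []

AllPairs-++-keyed : ∀ {L1 L2 K1 K2} → AllPairs _≺_ L1 → AllPairs _≺_ L2 → All (HasPrefix K1) L1 →
    All (HasPrefix K2) L2 → K1 ≺ K2 → AllPairs _≺_ (L1 ++ L2)
AllPairs-++-keyed ap1 ap2 h1 h2 k = APP.++⁺ ap1 ap2 (All.map (λ pu → All.map (λ pv → HasPrefix-≺ k pu pv) h2) h1)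


-- Splitting the BWT into classes

prefix? : (x : Word) → (u : Word) → Dec (isPrefix x u ≡ true)
prefix? x u = isPrefix x u ≟B true

filter-prefix-accept : ∀ x {u} L → isPrefix x u ≡ true → filter (prefix? x) (u ∷ L) ≡ u ∷ filter (prefix? x) L
filter-prefix-accept x L p = filter-accept (prefix? x) p

filter-prefix-reject : ∀ x {u} L → isPrefix x u ≡ false → filter (prefix? x) (u ∷ L) ≡ filter (prefix? x) L
filter-prefix-reject x {u} L p = filter-reject (prefix? x) (λ q → f≢t (trans (sym p) q))
  where
  f≢t : false ≡ true → ⊥
  f≢t ()

HasPrefixIn : List Word → Word → Set
HasPrefixIn keys u = Any (λ x → isPrefix x u ≡ true) keys

≺-All⇒¬prefix : ∀ {x keys} u → All (x ≺_) keys → HasPrefixIn keys u → isPrefix x u ≡ false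
≺-All⇒¬prefix u (h ∷ hs) (here p) = ≺⇒¬prefixˡ u h p
≺-All⇒¬prefix u (h ∷ hs) (there p) = ≺-All⇒¬prefix u hs p

concat-map-const-[] : ∀ (xs : List Word) → concat (map (λ (x : Word) → [] {A = Word}) xs) ≡ []
concat-map-const-[] [] = refl
concat-map-const-[] (x ∷ xs) = concat-map-const-[] xs

partition-∷ : ∀ keys u L → AllPairs _≺_ keys → HasPrefixIn keys u →
  concat (map (λ x → filter (prefix? x) (u ∷ L)) keys) ↭ u ∷ concat (map (λ x → filter (prefix? x) L) keys)
partition-∷ (x ∷ keys) u L (hx ∷ hxs) (here pu) =
  ↭-reflexive (cong₂ _++_ (filter-prefix-accept x L pu) (rest keys hx))
  where
  rest : ∀ ys → All (x ≺_) ys → concat (map (λ y → filter (prefix? y) (u ∷ L)) ys) ≡ concat (map (λ y →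
      filter (prefix? y) L) ys)
  rest [] [] = refl
  rest (y ∷ ys) (h ∷ hs) = cong₂ _++_ (filter-prefix-reject y L (≺⇒¬prefixʳ u h pu)) (rest ys hs)
partition-∷ (x ∷ keys) u L (hx ∷ hxs) (there any) =
  ↭-trans (↭-reflexive (cong (_++ concat (map (λ y → filter (prefix? y) (u ∷ L)) keys))
      (filter-prefix-reject x L (≺-All⇒¬prefix u hx any))))
  (↭-trans (++⁺ˡ (filter (prefix? x) L) (partition-∷ keys u L hxs any))
           (shift u (filter (prefix? x) L) (concat (map (λ y → filter (prefix? y) L) keys))))

partition-↭ : ∀ keys L → AllPairs _≺_ keys → All (HasPrefixIn keys) L → L ↭ concat (map (λ x →
    filter (prefix? x) L) keys)
partition-↭ keys [] h [] = ↭-reflexive (sym (concat-map-const-[] keys))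
partition-↭ keys (u ∷ L) h (pu ∷ pL) = ↭-sym (↭-trans (partition-∷ keys u L h pu) (↭-prep u (↭-sym
    (partition-↭ keys L h pL))))

SortedClass : (Word → List Word) → Word → Set
SortedClass F x = Sorted (F x) × All (λ u → isPrefix x u ≡ true) (F x)

concat-classes-sorted : ∀ keys (F : Word → List Word) → AllPairs _≺_ keys → All (SortedClass F) keys →
    Sorted (concat (map F keys))
concat-classes-sorted [] F h hs = []
concat-classes-sorted (x ∷ keys) F (hx ∷ hxs) ((sx , px) ∷ hs) =
  APP.++⁺ sx (concat-classes-sorted keys F hxs hs) (All.map (λ {u} pu → cross u pu keys hx hs) px)
  where
  cross : ∀ u → isPrefix x u ≡ true → ∀ ys → All (x ≺_) ys → All (SortedClass F) ys → All (Lex≤ u) (concat (map F ys))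
  cross u pu [] [] [] = []
  cross u pu (y ∷ ys) (h ∷ hs') ((_ , py) ∷ hs'') =
    AllP.++⁺ (All.map (λ {v} pv → ≺⇒Lex≤ (HasPrefix-≺ h (isPrefix⇒HasPrefix x u pu) (isPrefix⇒HasPrefix
        y v pv))) py) (cross u pu ys hs' hs'')

sortWords-by-classes : ∀ w keys → AllPairs _≺_ keys → All (HasPrefixIn keys) (conjugates w) →
  sortWords (conjugates w) ≡ concat (map (λ x → filter (prefix? x) (sortWords (conjugates w))) keys)
sortWords-by-classes w keys h hall =
  sorted-↭⇒≡ (sortWords-sorted L)
    (concat-classes-sorted keys (λ x → filter (prefix? x) S) h (okAll keys))
    (partition-↭ keys S h (All-resp-↭ (↭-sym (sortWords-↭ L)) hall))
  where
  L = conjugates w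
  S = sortWords L
  okAll : ∀ ys → All (SortedClass (λ x → filter (prefix? x) S)) ys
  okAll [] = []
  okAll (y ∷ ys) = (APP.filter⁺ (prefix? y) (sortWords-sorted L) , AllP.all-filter (prefix? y) S) ∷ okAll ys

filter-sortWords : ∀ x L T → Sorted T → T ↭ filter (prefix? x) L → filter (prefix? x) (sortWords L) ≡ T
filter-sortWords x L T sT p = sorted-↭⇒≡ (APP.filter⁺ (prefix? x) (sortWords-sorted L)) sT
    (↭-trans (filter-↭ (prefix? x) (sortWords-↭ L)) (↭-sym p))

BWT≡concat-β : ∀ w keys → AllPairs _≺_ keys → All (HasPrefixIn keys) (conjugates w) → BWT w
    ≡ concat (map (λ x → β x w) keys)
BWT≡concat-β w keys h hall = trans (cong (map lastL) (sortWords-by-classes w keys h hall))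
  (trans (sym (concat-map {f = lastL} (map (λ x → filter (prefix? x) (sortWords (conjugates w))) keys)))
         (cong concat (sym (map-∘ keys))))


lastL-++ : ∀ u x v → lastL (u ++ x ∷ v) ≡ lastL (x ∷ v)
lastL-++ [] x v = refl
lastL-++ (y ∷ []) x v = refl
lastL-++ (y ∷ y' ∷ u) x v = lastL-++ (y' ∷ u) x v

EndsWith : Letter → Word → Set
EndsWith c w = Σ Word (λ z → w ≡ z ++ c ∷ [])

EndsWith-lastL : ∀ {c w} → EndsWith c w → lastL w ≡ c
EndsWith-lastL {c} (z , refl) = lastL-++ z c []

EndsWith-++ : ∀ {c} u {v} → EndsWith c v → EndsWith c (u ++ v)
EndsWith-++ {c} u (z , refl) = u ++ z , sym (++-assoc u z (c ∷ []))

EndsWith-++[] : ∀ {c} {u} → EndsWith c u → EndsWith c (u ++ [])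
EndsWith-++[] {c} {u} h rewrite ++-identityʳ u = h

EndsWith-run : ∀ n c → EndsWith c (run (suc n) c)
EndsWith-run zero c = [] , refl
EndsWith-run (suc n) c with EndsWith-run n c
... | z , e = c ∷ z , cong (c ∷_) e


applyUpTo-+ : ∀ {A : Set} (f : ℕ → A) m n → applyUpTo f (m + n) ≡ applyUpTo f m ++ applyUpTo (λ q → f (m + q)) n
applyUpTo-+ f zero n = refl
applyUpTo-+ f (suc m) n = cong (f 0 ∷_) (applyUpTo-+ (λ q → f (suc q)) m n)

applyUpTo-cong : ∀ {A : Set} {f g : ℕ → A} n → (∀ p → p < n → f p ≡ g p) → applyUpTo f n ≡ applyUpTo g n
applyUpTo-cong zero h = refl
applyUpTo-cong (suc n) h = cong₂ _∷_ (h 0 (s≤s z≤n)) (applyUpTo-cong n (λ p lt → h (suc p) (s≤s lt)))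

rotations : Word → Word → Word → List Word
rotations X S Y = applyUpTo (λ p → drop p S ++ Y ++ X ++ take p S) (length S)

conjugates-rotations : ∀ w → conjugates w ≡ rotations [] w []
conjugates-rotations w = map-upTo (conj w) (length w)

drop-++ˡ : ∀ {A : Set} p (S1 S2 : List A) → p ≤ length S1 → drop p (S1 ++ S2) ≡ drop p S1 ++ S2
drop-++ˡ zero S1 S2 h = refl
drop-++ˡ (suc p) (x ∷ S1) S2 (s≤s h) = drop-++ˡ p S1 S2 h

take-++ˡ : ∀ {A : Set} p (S1 S2 : List A) → p ≤ length S1 → take p (S1 ++ S2) ≡ take p S1
take-++ˡ zero S1 S2 h = refl
take-++ˡ (suc p) (x ∷ S1) S2 (s≤s h) = cong (x ∷_) (take-++ˡ p S1 S2 h)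

drop-length-++ : ∀ {A : Set} (S1 S2 : List A) q → drop (length S1 + q) (S1 ++ S2) ≡ drop q S2
drop-length-++ [] S2 q = refl
drop-length-++ (x ∷ S1) S2 q = drop-length-++ S1 S2 q

take-length-++ : ∀ {A : Set} (S1 S2 : List A) q → take (length S1 + q) (S1 ++ S2) ≡ S1 ++ take q S2
take-length-++ [] S2 q = refl
take-length-++ (x ∷ S1) S2 q = cong (x ∷_) (take-length-++ S1 S2 q)

rotations-++ : ∀ X S1 S2 Y → rotations X (S1 ++ S2) Y ≡ rotations X S1 (S2 ++ Y) ++ rotations (X ++ S1) S2 Y
rotations-++ X S1 S2 Y =
  trans (cong (applyUpTo f) (length-++ S1))
  (trans (applyUpTo-+ f (length S1) (length S2))
  (cong₂ _++_ (applyUpTo-cong (length S1) h1) (applyUpTo-cong (length S2) h2)))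
  where
  f : ℕ → Word
  f p = drop p (S1 ++ S2) ++ Y ++ X ++ take p (S1 ++ S2)
  h1 : ∀ p → p < length S1 → f p ≡ drop p S1 ++ (S2 ++ Y) ++ X ++ take p S1
  h1 p lt rewrite drop-++ˡ p S1 S2 (<⇒≤ lt) | take-++ˡ p S1 S2 (<⇒≤ lt) = trans
      (++-assoc (drop p S1) S2 (Y ++ X ++ take p S1)) (cong (drop p S1 ++_) (sym (++-assoc S2 Y (X ++ take p S1))))
  h2 : ∀ q → q < length S2 → f (length S1 + q) ≡ drop q S2 ++ Y ++ (X ++ S1) ++ take q S2
  h2 q lt rewrite drop-length-++ S1 S2 q | take-length-++ S1 S2 q | ++-assoc X S1 (take q S2) = refl

conjugates-++-comm : ∀ u v → conjugates (u ++ v) ↭ conjugates (v ++ u)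
conjugates-++-comm u v =
  ↭-trans (↭-reflexive (trans (conjugates-rotations (u ++ v)) (rotations-++ [] u v [])))
  (↭-trans (↭-reflexive (cong₂ _++_ e1 e2))
  (↭-trans (++-comm (rotations v u []) (rotations [] v (u ++ [])))
  (↭-reflexive (sym (trans (conjugates-rotations (v ++ u)) (rotations-++ [] v u []))))))
  where
  e1 : rotations [] u (v ++ []) ≡ rotations v u []
  e1 = applyUpTo-cong (length u) (λ p _ → cong (λ z → drop p u ++ z ++ take p u) (++-identityʳ v))
  e2 : rotations u v [] ≡ rotations [] v (u ++ [])
  e2 = applyUpTo-cong (length v) (λ p _ → cong (λ z → drop p v ++ z ++ take p v) (sym (++-identityʳ u)))

drop-run : ∀ p ℓ c → drop p (run ℓ c) ≡ run (ℓ ∸ p) c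
drop-run zero ℓ c = refl
drop-run (suc p) zero c = refl
drop-run (suc p) (suc ℓ) c = drop-run p ℓ c

take-run : ∀ p ℓ c → p ≤ ℓ → take p (run ℓ c) ≡ run p c
take-run zero ℓ c h = refl
take-run (suc p) (suc ℓ) c (s≤s h) = cong (c ∷_) (take-run p ℓ c h)

rotations-run : ∀ X c ℓ Y → rotations X (run ℓ c) Y ≡ applyUpTo (λ p → run (ℓ ∸ p) c ++ Y ++ X ++ run p c) ℓ
rotations-run X c ℓ Y =
  trans (cong (applyUpTo (λ p → drop p (run ℓ c) ++ Y ++ X ++ take p (run ℓ c))) (length-replicate ℓ))
        (applyUpTo-cong ℓ (λ p lt → cong₂ (λ u v → u ++ Y ++ X ++ v) (drop-run p ℓ c) (take-run p ℓ c (<⇒≤ lt))))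


-- Conjugates starting inside a run

other : Letter → Letter
other a = b
other b = a

key : Letter → ℕ → Word
key c e = run e c ++ other c ∷ []

HasHead : Letter → Word → Set
HasHead d w = Σ Word (λ w' → w ≡ d ∷ w')

HasHead-++ : ∀ {d} Y X → HasHead d Y → HasHead d (Y ++ X)
HasHead-++ Y X (w , refl) = w ++ X , refl

HasHead-++-++ : ∀ {d} Y X q → HasHead d (Y ++ X) → HasHead d (Y ++ X ++ q)
HasHead-++-++ {d} Y X q (w , e) = w ++ q , trans (sym (++-assoc Y X q)) (cong (_++ q) e)

key-¬prefix : ∀ c e n w → ¬ (e ≡ n) → isPrefix (key c e) (run n c ++ other c ∷ w) ≡ false
key-¬prefix c zero zero w ne = ⊥-elim (ne refl)
key-¬prefix a zero (suc n) w ne = refl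
key-¬prefix b zero (suc n) w ne = refl
key-¬prefix a (suc e) zero w ne = refl
key-¬prefix b (suc e) zero w ne = refl
key-¬prefix a (suc e) (suc n) w ne = key-¬prefix a e n w (λ q → ne (cong suc q))
key-¬prefix b (suc e) (suc n) w ne = key-¬prefix b e n w (λ q → ne (cong suc q))

key-prefix : ∀ c e w → isPrefix (key c e) (run e c ++ other c ∷ w) ≡ true
key-prefix c e w = subst (λ z → isPrefix (key c e) z ≡ true) (++-assoc (run e c) (other c ∷ []) w)
    (isPrefix-++ (key c e) w)

key-¬prefix′ : ∀ c e n z → HasHead (other c) z → ¬ (e ≡ n) → isPrefix (key c e) (run n c ++ z) ≡ false
key-¬prefix′ c e n .(other c ∷ w) (w , refl) ne = key-¬prefix c e n w ne

key-prefix′ : ∀ c e z → HasHead (other c) z → isPrefix (key c e) (run e c ++ z) ≡ true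
key-prefix′ c e .(other c ∷ w) (w , refl) = key-prefix c e w

key-other-¬prefix : ∀ c e n z → isPrefix (key (other c) (suc e)) (run (suc n) c ++ z) ≡ false
key-other-¬prefix a e n z = refl
key-other-¬prefix b e n z = refl

filter-run-miss : ∀ c ℓ e (Z : ℕ → Word) → (∀ p → HasHead (other c) (Z p)) → ℓ < e →
  filter (prefix? (key c e)) (applyUpTo (λ p → run (ℓ ∸ p) c ++ Z p) ℓ) ≡ []
filter-run-miss c zero e Z hz lt = refl
filter-run-miss c (suc ℓ) e Z hz lt =
  trans (filter-prefix-reject (key c e) _ (key-¬prefix′ c e (suc ℓ) (Z 0) (hz 0) (λ q →
      <-irrefl refl (subst (suc ℓ <_) q lt))))
        (filter-run-miss c ℓ e (λ p → Z (suc p)) (λ p → hz (suc p)) (<⇒≤ lt))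

filter-run-hit : ∀ c ℓ e (Z : ℕ → Word) → (∀ p → HasHead (other c) (Z p)) → 1 ≤ e → e ≤ ℓ →
  filter (prefix? (key c e)) (applyUpTo (λ p → run (ℓ ∸ p) c ++ Z p) ℓ) ≡ (run e c ++ Z (ℓ ∸ e)) ∷ []
filter-run-hit c zero (suc e) Z hz h1 ()
filter-run-hit c (suc ℓ) e Z hz h1 h with e ≟ suc ℓ
... | yes refl =
  trans (filter-prefix-accept (key c e) _ (key-prefix′ c e (Z 0) (hz 0)))
        (cong₂ (λ u v → (run e c ++ Z u) ∷ v) (sym (n∸n≡0 ℓ))
               (filter-run-miss c ℓ e (λ p → Z (suc p)) (λ p → hz (suc p)) ≤-refl))
... | no ne =
  trans (filter-prefix-reject (key c e) _ (key-¬prefix′ c e (suc ℓ) (Z 0) (hz 0) ne))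
        (trans (filter-run-hit c ℓ e (λ p → Z (suc p)) (λ p → hz (suc p)) h1 le)
               (cong (λ u → (run e c ++ Z u) ∷ []) (sym (+-∸-assoc 1 le))))
  where
  le : e ≤ ℓ
  le = ≤-pred (≤∧≢⇒< h ne)

filter-run-other : ∀ c ℓ e (Z : ℕ → Word) →
  filter (prefix? (key (other c) (suc e))) (applyUpTo (λ p → run (ℓ ∸ p) c ++ Z p) ℓ) ≡ []
filter-run-other c zero e Z = refl
filter-run-other c (suc ℓ) e Z =
  trans (filter-prefix-reject (key (other c) (suc e)) _ (key-other-¬prefix c e ℓ (Z 0)))
      (filter-run-other c ℓ e (λ p → Z (suc p)))

runRotations : Letter → ℕ → Word → Word → List Word
runRotations c ℓ Y X = applyUpTo (λ p → run (ℓ ∸ p) c ++ Y ++ X ++ run p c) ℓ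

runConj : Letter → ℕ → Word → Word → ℕ → Word
runConj c e Y X s = run e c ++ Y ++ X ++ run s c

runConj-lastL-suc : ∀ c e Y X s → lastL (runConj c e Y X (suc s)) ≡ c
runConj-lastL-suc c e Y X s = EndsWith-lastL (EndsWith-++ (run e c) (EndsWith-++ Y (EndsWith-++ X (EndsWith-run s c))))

runConj-lastL-pos : ∀ c e Y X s → 1 ≤ s → lastL (runConj c e Y X s) ≡ c
runConj-lastL-pos c e Y X (suc s) _ = runConj-lastL-suc c e Y X s

runConj-lastL-0 : ∀ c d e Y X → EndsWith d (Y ++ X) → lastL (runConj c e Y X 0) ≡ d
runConj-lastL-0 c d e Y X h rewrite ++-identityʳ X = EndsWith-lastL (EndsWith-++ (run e c) h)

filter-runRotations-hit : ∀ c ℓ Y X e → HasHead (other c) (Y ++ X) → 1 ≤ e → e ≤ ℓ →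
    filter (prefix? (key c e)) (runRotations c ℓ Y X) ≡ runConj c e Y X (ℓ ∸ e) ∷ []
filter-runRotations-hit c ℓ Y X e h h1 h2 = filter-run-hit c ℓ e (λ p → Y ++ X ++ run p c) (λ p →
    HasHead-++-++ Y X (run p c) h) h1 h2

filter-runRotations-miss : ∀ c ℓ Y X e → HasHead (other c) (Y ++ X) → ℓ < e →
    filter (prefix? (key c e)) (runRotations c ℓ Y X) ≡ []
filter-runRotations-miss c ℓ Y X e h h1 = filter-run-miss c ℓ e (λ p → Y ++ X ++ run p c) (λ p →
    HasHead-++-++ Y X (run p c) h) h1

filter-runRotations-other : ∀ c ℓ Y X e → filter (prefix? (key (other c) (suc e))) (runRotations c ℓ Y X) ≡ []
filter-runRotations-other c ℓ Y X e = filter-run-other c ℓ e (λ p → Y ++ X ++ run p c)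

pick : Letter → ℕ → Word → Word → ℕ → List Word
pick c ℓ Y X e = if e ≤ᵇ ℓ then runConj c e Y X (ℓ ∸ e) ∷ [] else []

pick-hit : ∀ c ℓ Y X e → e ≤ ℓ → pick c ℓ Y X e ≡ runConj c e Y X (ℓ ∸ e) ∷ []
pick-hit c ℓ Y X e h with e ≤ᵇ ℓ | ≤⇒≤ᵇ h
... | true | _ = refl

pick-miss : ∀ c ℓ Y X e → ℓ < e → pick c ℓ Y X e ≡ []
pick-miss c ℓ Y X e h with e ≤ᵇ ℓ | ≤ᵇ⇒≤ e ℓ
... | true | f = ⊥-elim (<-irrefl refl (≤-trans h (f _)))
... | false | _ = refl

filter-runRotations : ∀ c ℓ Y X e → HasHead (other c) (Y ++ X) → 1 ≤ e →
    filter (prefix? (key c e)) (runRotations c ℓ Y X) ≡ pick c ℓ Y X e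
filter-runRotations c ℓ Y X e h h1 with e ≤? ℓ
... | yes le = trans (filter-runRotations-hit c ℓ Y X e h h1 le) (sym (pick-hit c ℓ Y X e le))
... | no nle = trans (filter-runRotations-miss c ℓ Y X e h (≰⇒> nle)) (sym (pick-miss c ℓ Y X e (≰⇒> nle)))

filter-++² : ∀ x (A₁ A₂ : List Word) {o1 o2} →
  filter (prefix? x) A₁ ≡ o1 → filter (prefix? x) A₂ ≡ o2 →
      filter (prefix? x) (A₁ ++ A₂) ≡ o1 ++ o2
filter-++² x A₁ A₂ e1 e2 = trans (filter-++ (prefix? x) A₁ _) (cong₂ _++_ e1 e2)

filter-++⁶ : ∀ x (A₁ A₂ A₃ A₄ A₅ A₆ : List Word) {o1 o2 o3 o4 o5 o6} →
  filter (prefix? x) A₁ ≡ o1 → filter (prefix? x) A₂ ≡ o2 → filter (prefix? x) A₃ ≡ o3 →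
  filter (prefix? x) A₄ ≡ o4 → filter (prefix? x) A₅ ≡ o5 → filter (prefix? x) A₆ ≡ o6 →
  filter (prefix? x) (A₁ ++ A₂ ++ A₃ ++ A₄ ++ A₅ ++ A₆) ≡ o1 ++ o2 ++ o3 ++ o4 ++ o5 ++ o6
filter-++⁶ x A₁ A₂ A₃ A₄ A₅ A₆ e1 e2 e3 e4 e5 e6 =
  trans (filter-++ (prefix? x) A₁ _) (cong₂ _++_ e1
  (trans (filter-++ (prefix? x) A₂ _) (cong₂ _++_ e2
  (trans (filter-++ (prefix? x) A₃ _) (cong₂ _++_ e3
  (trans (filter-++ (prefix? x) A₄ _) (cong₂ _++_ e4
  (trans (filter-++ (prefix? x) A₅ _) (cong₂ _++_ e5 e6)))))))))


InRange : ℕ → ℕ → ℕ → Set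
InRange lo n i = lo ≤ i × i < lo + n

inRange-head : ∀ lo n → InRange lo (suc n) lo
inRange-head lo n = ≤-refl , subst (lo <_) (sym (+-suc lo n)) (s≤s (m≤m+n lo n))

inRange-tail : ∀ lo n i → InRange (suc lo) n i → InRange lo (suc n) i
inRange-tail lo n i (h1 , h2) = <⇒≤ h1 , subst (i <_) (sym (+-suc lo n)) h2

inRange⇒< : ∀ {lo hi i} → lo ≤ hi → InRange lo (hi ∸ lo) i → i < hi
inRange⇒< {lo} {hi} {i} h (_ , lt) = subst (i <_) (m+[n∸m]≡n h) lt

module _ {A : Set} where
  concatFrom : ℕ → ℕ → (ℕ → List A) → List A
  concatFrom lo zero f = []
  concatFrom lo (suc n) f = f lo ++ concatFrom (suc lo) n f

  concatFromRev : ℕ → ℕ → (ℕ → List A) → List A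
  concatFromRev lo zero f = []
  concatFromRev lo (suc n) f = concatFromRev (suc lo) n f ++ f lo

  concatFrom-cong : ∀ lo n {f g : ℕ → List A} → (∀ i → InRange lo n i → f i ≡ g i) → concatFrom lo n f
      ≡ concatFrom lo n g
  concatFrom-cong lo zero h = refl
  concatFrom-cong lo (suc n) h = cong₂ _++_ (h lo (inRange-head lo n))
      (concatFrom-cong (suc lo) n (λ i r → h i (inRange-tail lo n i r)))

  concatFrom-+ : ∀ lo m n (f : ℕ → List A) → concatFrom lo (m + n) f ≡ concatFrom lo m f ++ concatFrom (lo + m) n f
  concatFrom-+ lo zero n f rewrite +-identityʳ lo = refl
  concatFrom-+ lo (suc m) n f rewrite concatFrom-+ (suc lo) m n f | +-suc lo m = sym
      (++-assoc (f lo) (concatFrom (suc lo) m f) _)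

  concatFrom-[] : ∀ lo n (f : ℕ → List A) → (∀ i → InRange lo n i → f i ≡ []) → concatFrom lo n f ≡ []
  concatFrom-[] lo zero f h = refl
  concatFrom-[] lo (suc n) f h rewrite h lo (inRange-head lo n) = concatFrom-[] (suc lo) n f (λ i r →
      h i (inRange-tail lo n i r))

  concatFrom-unzip : ∀ lo n (f g : ℕ → List A) → concatFrom lo n (λ i → f i ++ g i)
      ↭ concatFrom lo n f ++ concatFrom lo n g
  concatFrom-unzip lo zero f g = ↭-refl
  concatFrom-unzip lo (suc n) f g =
    ↭-trans (↭-reflexive (++-assoc (f lo) (g lo) _))
    (↭-trans (++⁺ˡ (f lo) (++⁺ˡ (g lo) (concatFrom-unzip (suc lo) n f g)))
    (↭-trans (++⁺ˡ (f lo) (shifts (g lo) (concatFrom (suc lo) n f)))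
    (↭-reflexive (sym (++-assoc (f lo) (concatFrom (suc lo) n f) _)))))

  concatFromRev-↭ : ∀ lo n (f : ℕ → List A) → concatFromRev lo n f ↭ concatFrom lo n f
  concatFromRev-↭ lo zero f = ↭-refl
  concatFromRev-↭ lo (suc n) f = ↭-trans (++-comm (concatFromRev (suc lo) n f) (f lo))
      (++⁺ˡ (f lo) (concatFromRev-↭ (suc lo) n f))

  concatFrom-All : ∀ {P : A → Set} lo n (f : ℕ → List A) → (∀ i → InRange lo n i → All P (f i)) →
      All P (concatFrom lo n f)
  concatFrom-All lo zero f h = []
  concatFrom-All lo (suc n) f h = AllP.++⁺ (h lo (inRange-head lo n))
      (concatFrom-All (suc lo) n f (λ i r → h i (inRange-tail lo n i r)))

  concatFromRev-All : ∀ {P : A → Set} lo n (f : ℕ → List A) → (∀ i → InRange lo n i → All P (f i)) →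
      All P (concatFromRev lo n f)
  concatFromRev-All lo zero f h = []
  concatFromRev-All lo (suc n) f h = AllP.++⁺ (concatFromRev-All (suc lo) n f (λ i r →
      h i (inRange-tail lo n i r))) (h lo (inRange-head lo n))

  concatFrom-AllPairs : ∀ {R : A → A → Set} lo n (f : ℕ → List A) → (∀ i → InRange lo n i → AllPairs R (f i)) →
          (∀ i j → InRange lo n i → InRange lo n j → i < j → All (λ u → All (R u) (f j)) (f i)) →
          AllPairs R (concatFrom lo n f)
  concatFrom-AllPairs lo zero f h1 h2 = []
  concatFrom-AllPairs {R} lo (suc n) f h1 h2 =
    APP.++⁺ (h1 lo (inRange-head lo n)) (concatFrom-AllPairs (suc lo) n f (λ i r →
        h1 i (inRange-tail lo n i r)) (λ i j ri rj → h2 i j (inRange-tail lo n i ri) (inRange-tail lo n j rj)))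
      (All.map (λ {u} pu → concatFrom-All (suc lo) n f (λ j rj →
          All.lookup (h2 lo j (inRange-head lo n) (inRange-tail lo n j rj) (proj₁ rj)) pu))
          (All.tabulate (λ {u} m → m)))

  concatFromRev-AllPairs : ∀ {R : A → A → Set} lo n (f : ℕ → List A) → (∀ i → InRange lo n i → AllPairs R (f i)) →
          (∀ i j → InRange lo n i → InRange lo n j → i < j → All (λ u → All (R u) (f i)) (f j)) →
          AllPairs R (concatFromRev lo n f)
  concatFromRev-AllPairs lo zero f h1 h2 = []
  concatFromRev-AllPairs {R} lo (suc n) f h1 h2 =
    APP.++⁺ (concatFromRev-AllPairs (suc lo) n f (λ i r → h1 i (inRange-tail lo n i r)) (λ i j ri rj →
        h2 i j (inRange-tail lo n i ri) (inRange-tail lo n j rj)))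
      (h1 lo (inRange-head lo n))
      (concatFromRev-All (suc lo) n f (λ j rj → h2 lo j (inRange-head lo n) (inRange-tail lo n j rj) (proj₁ rj)))

  filter-concatFrom : ∀ {P : A → Set} (P? : (x : A) → Dec (P x)) lo n (f : ℕ → List A) →
      filter P? (concatFrom lo n f) ≡ concatFrom lo n (λ i → filter P? (f i))
  filter-concatFrom P? lo zero f = refl
  filter-concatFrom P? lo (suc n) f = trans (filter-++ P? (f lo) _)
      (cong (filter P? (f lo) ++_) (filter-concatFrom P? (suc lo) n f))

  concatFrom-const : ∀ lo n (x : A) → concatFrom lo n (λ i → x ∷ []) ≡ replicate n x
  concatFrom-const lo zero x = refl
  concatFrom-const lo (suc n) x = cong (x ∷_) (concatFrom-const (suc lo) n x)

  concatFromRev-const : ∀ lo n (x : A) → concatFromRev lo n (λ i → x ∷ []) ≡ replicate n x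
  concatFromRev-const lo zero x = refl
  concatFromRev-const lo (suc n) x = trans (cong (_++ x ∷ []) (concatFromRev-const (suc lo) n x)) (replicate-∷ʳ n)
    where
    replicate-∷ʳ : ∀ m → replicate m x ++ x ∷ [] ≡ x ∷ replicate m x
    replicate-∷ʳ zero = refl
    replicate-∷ʳ (suc m) = cong (x ∷_) (replicate-∷ʳ m)

  concatFromRev-cong : ∀ lo n {f g : ℕ → List A} → (∀ i → InRange lo n i → f i ≡ g i) →
      concatFromRev lo n f ≡ concatFromRev lo n g
  concatFromRev-cong lo zero h = refl
  concatFromRev-cong lo (suc n) h = cong₂ _++_ (concatFromRev-cong (suc lo) n (λ i r →
      h i (inRange-tail lo n i r))) (h lo (inRange-head lo n))

  concatFrom-↭ : ∀ lo n {f g : ℕ → List A} → (∀ i → f i ↭ g i) → concatFrom lo n f ↭ concatFrom lo n g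
  concatFrom-↭ lo zero h = ↭-refl
  concatFrom-↭ lo (suc n) h = ++⁺ (h lo) (concatFrom-↭ (suc lo) n h)

  concatFrom-∷ʳ : ∀ lo n (f : ℕ → List A) → concatFrom lo (suc n) f ≡ concatFrom lo n f ++ f (lo + n)
  concatFrom-∷ʳ lo zero f rewrite +-identityʳ lo = ++-identityʳ (f lo)
  concatFrom-∷ʳ lo (suc n) f rewrite concatFrom-∷ʳ (suc lo) n f | +-suc lo n = sym
      (++-assoc (f lo) (concatFrom (suc lo) n f) (f (suc (lo + n))))

  concat-applyUpTo : ∀ lo n (f : ℕ → List A) (h : ℕ → List A) → (∀ j → h j ≡ f (lo + j)) →
      concat (applyUpTo h n) ≡ concatFrom lo n f
  concat-applyUpTo lo zero f h e = refl
  concat-applyUpTo lo (suc n) f h e =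
    cong₂ _++_ (trans (e 0) (cong f (+-identityʳ lo)))
      (concat-applyUpTo (suc lo) n f (λ j → h (suc j)) (λ j → trans (e (suc j)) (cong f (+-suc lo j))))


∸-split : ∀ {x y z} → x ≤ y → y ≤ z → (y ∸ x) + (z ∸ y) ≡ z ∸ x
∸-split {x} {y} {z} xy yz = trans (sym (m+n∸m≡n x _))
    (cong (_∸ x) (trans (sym (+-assoc x (y ∸ x) (z ∸ y))) (trans (cong (_+ (z ∸ y)) (m+[n∸m]≡n xy)) (m+[n∸m]≡n yz))))

concatFrom-split : ∀ {A : Set} lo mid hi (G : ℕ → List A) → lo ≤ mid → mid ≤ hi →
    concatFrom lo (hi ∸ lo) G ≡ concatFrom lo (mid ∸ lo) G ++ concatFrom mid (hi ∸ mid) G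
concatFrom-split lo mid hi G h1 h2 = trans (cong (λ z → concatFrom lo z G) (sym (∸-split h1 h2)))
  (trans (concatFrom-+ lo (mid ∸ lo) (hi ∸ mid) G) (cong (λ z →
      concatFrom lo (mid ∸ lo) G ++ concatFrom z (hi ∸ mid) G) (m+[n∸m]≡n h1)))

map-concatFrom : ∀ {A B : Set} (h : A → B) lo n (f : ℕ → List A) → map h (concatFrom lo n f)
    ≡ concatFrom lo n (λ i → map h (f i))
map-concatFrom h lo zero f = refl
map-concatFrom h lo (suc n) f = trans (map-++ h (f lo) _) (cong (map h (f lo) ++_) (map-concatFrom h (suc lo) n f))

map-concatFromRev : ∀ {A B : Set} (h : A → B) lo n (f : ℕ → List A) → map h (concatFromRev lo n f)
    ≡ concatFromRev lo n (λ i → map h (f i))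
map-concatFromRev h lo zero f = refl
map-concatFromRev h lo (suc n) f = trans (map-++ h (concatFromRev (suc lo) n f) _)
    (cong (_++ map h (f lo)) (map-concatFromRev h (suc lo) n f))

prod≡concatFrom : ∀ lo hi (f : ℕ → Word) → prod lo hi f ≡ concatFrom lo (suc hi ∸ lo) f
prod≡concatFrom lo hi f = trans (cong concat (map-upTo (λ j →
    f (lo + j)) (suc hi ∸ lo))) (concat-applyUpTo lo (suc hi ∸ lo) f (λ j → f (lo + j)) (λ j → refl))

concat-map-upTo≡prod : ∀ (F : ℕ → Word) lo hi (G : Word → Word) (fa : ℕ → Word) → (∀ j → G (fa j) ≡ F (lo + j)) →
  concat (map G (map fa (upTo (suc hi ∸ lo)))) ≡ prod lo hi F
concat-map-upTo≡prod F lo hi G fa hyp = cong concat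
    (trans (sym (map-∘ (upTo (suc hi ∸ lo)))) (map-cong hyp (upTo (suc hi ∸ lo))))


module RankedBy (κ : ℕ → Word) (N : ℕ) (mono : ∀ {r s} → r < s → s < N → κ r ≺ κ s) where
  KeyIn : ℕ → ℕ → Word → Set
  KeyIn lo hi u = Σ ℕ (λ r → lo ≤ r × r < hi × HasPrefix (κ r) u)

  Ranked : ℕ → ℕ → List Word → Set
  Ranked lo hi L = AllPairs _≺_ L × All (KeyIn lo hi) L

  Ranked-[] : ∀ {lo hi} → Ranked lo hi []
  Ranked-[] = [] , []

  Ranked-single : ∀ {lo hi} r u → lo ≤ r → r < hi → HasPrefix (κ r) u → Ranked lo hi (u ∷ [])
  Ranked-single r u h1 h2 hp = ([] ∷ []) , ((r , h1 , h2 , hp) ∷ [])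

  KeyIn-weaken : ∀ {lo hi lo' hi'} → lo' ≤ lo → hi ≤ hi' → ∀ {u} → KeyIn lo hi u → KeyIn lo' hi' u
  KeyIn-weaken l h (r , h1 , h2 , hp) = r , ≤-trans l h1 , ≤-trans h2 h , hp

  Ranked-++ : ∀ {lo mid hi L1 L2} → lo ≤ mid → mid ≤ hi → hi ≤ N → Ranked lo mid L1 → Ranked mid hi L2 →
      Ranked lo hi (L1 ++ L2)
  Ranked-++ {lo} {mid} {hi} {L1} {L2} lm mh hN (ap1 , al1) (ap2 , al2) =
    APP.++⁺ ap1 ap2 (All.map (λ {u} iu → All.map (λ {v} iv → cross iu iv) al2) al1) ,
    AllP.++⁺ (All.map (KeyIn-weaken ≤-refl mh) al1) (All.map (KeyIn-weaken lm ≤-refl) al2)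
    where
    cross : ∀ {u v} → KeyIn lo mid u → KeyIn mid hi v → u ≺ v
    cross (r , _ , r<m , hpu) (s , m≤s , s<h , hpv) = HasPrefix-≺ (mono (≤-trans r<m m≤s) (≤-trans s<h hN)) hpu hpv

  Ranked-concatFrom : ∀ (g : ℕ → ℕ) lo n (f : ℕ → List Word) → g (lo + n) ≤ N →
          (∀ i → g i ≤ g (suc i)) →
          (∀ i → InRange lo n i → Ranked (g i) (g (suc i)) (f i)) → Ranked (g lo) (g (lo + n)) (concatFrom lo n f)
  Ranked-concatFrom g lo zero f hN gm h rewrite +-identityʳ lo = Ranked-[]
  Ranked-concatFrom g lo (suc n) f hN gm h =
    subst (λ z → Ranked (g lo) (g z) (concatFrom lo (suc n) f)) (sym (+-suc lo n))
      (Ranked-++ (gm lo) (gmono (suc lo) n) (subst (λ z → g z ≤ N) (+-suc lo n) hN)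
        (h lo (inRange-head lo n))
        (Ranked-concatFrom g (suc lo) n f (subst (λ z → g z ≤ N) (+-suc lo n) hN) gm (λ i r →
            h i (inRange-tail lo n i r))))
    where
    gmono : ∀ x m → g x ≤ g (x + m)
    gmono x zero rewrite +-identityʳ x = ≤-refl
    gmono x (suc m) rewrite +-suc x m = ≤-trans (gm x) (gmono (suc x) m)

  Ranked⇒AllPairs : ∀ {lo hi L} → Ranked lo hi L → AllPairs _≺_ L
  Ranked⇒AllPairs = proj₁

-- Ranks 2m and 2m + 1 hold b^m aa and b^m ab, which are the words that can follow a run of a's
-- in V.
trailKey : ℕ → Word
trailKey zero = a ∷ a ∷ []
trailKey (suc zero) = a ∷ b ∷ []
trailKey (suc (suc r)) = b ∷ trailKey r

trailKey-mono : ∀ {r s} → r < s → trailKey r ≺ trailKey s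
trailKey-mono {zero} {suc zero} _ = ≺-there ≺-here
trailKey-mono {suc zero} {suc zero} (s≤s ())
trailKey-mono {zero} {suc (suc s)} _ = ≺-here
trailKey-mono {suc zero} {suc (suc s)} _ = ≺-here
trailKey-mono {suc (suc r)} {suc (suc s)} (s≤s (s≤s h)) = ≺-there (trailKey-mono h)

dbl : ℕ → ℕ
dbl zero = zero
dbl (suc m) = suc (suc (dbl m))

rank-aa rank-ab : ℕ → ℕ
rank-aa m = dbl m
rank-ab m = suc (dbl m)

trailKey-aa : ∀ m → trailKey (rank-aa m) ≡ run m b ++ a ∷ a ∷ []
trailKey-aa zero = refl
trailKey-aa (suc m) = cong (b ∷_) (trailKey-aa m)

trailKey-ab : ∀ m → trailKey (rank-ab m) ≡ run m b ++ a ∷ b ∷ []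
trailKey-ab zero = refl
trailKey-ab (suc m) = cong (b ∷_) (trailKey-ab m)

dbl-≤ : ∀ {m n} → m ≤ n → dbl m ≤ dbl n
dbl-≤ z≤n = z≤n
dbl-≤ (s≤s h) = s≤s (s≤s (dbl-≤ h))

rank-ab-< : ∀ i → rank-ab i < rank-ab (suc i)
rank-ab-< i = s≤s (s≤s (m≤n⇒m≤1+n ≤-refl))


rank-ab-mono : ∀ {p q} → p ≤ q → rank-ab p ≤ rank-ab q
rank-ab-mono h = s≤s (dbl-≤ h)

rank-ab-step : ∀ i → rank-ab i ≤ rank-ab (suc i)
rank-ab-step i = ≤-trans (n≤1+n (rank-ab i)) (n≤1+n (suc (rank-ab i)))

-- Two index lists are permutations of each other if they sort to the same list, and for
-- literal lists this is checked by evaluation.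
insertℕ : ℕ → List ℕ → List ℕ
insertℕ x [] = x ∷ []
insertℕ x (y ∷ ys) = if x ≤ᵇ y then x ∷ y ∷ ys else y ∷ insertℕ x ys

sortℕ : List ℕ → List ℕ
sortℕ [] = []
sortℕ (x ∷ xs) = insertℕ x (sortℕ xs)

insertℕ-↭ : ∀ x xs → insertℕ x xs ↭ x ∷ xs
insertℕ-↭ x [] = ↭-refl
insertℕ-↭ x (y ∷ ys) with x ≤ᵇ y
... | true = ↭-refl
... | false = ↭-trans (↭-prep y (insertℕ-↭ x ys)) (↭-swap y x ↭-refl)

sortℕ-↭ : ∀ xs → sortℕ xs ↭ xs
sortℕ-↭ [] = ↭-refl
sortℕ-↭ (x ∷ xs) = ↭-trans (insertℕ-↭ x (sortℕ xs)) (↭-prep x (sortℕ-↭ xs))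

sortℕ-≡⇒↭ : ∀ π σ → sortℕ π ≡ sortℕ σ → π ↭ σ
sortℕ-≡⇒↭ π σ e = ↭-trans (↭-sym (sortℕ-↭ π)) (↭-trans (↭-reflexive e) (sortℕ-↭ σ))

concat-map-↭ : ∀ {A : Set} (f : ℕ → List A) {π σ} → π ↭ σ → concat (map f π) ↭ concat (map f σ)
concat-map-↭ f Pm.refl = ↭-refl
concat-map-↭ f (Pm.prep x p) = ++⁺ˡ (f x) (concat-map-↭ f p)
concat-map-↭ f (Pm.swap x y p) = ↭-trans (shifts (f x) (f y)) (++⁺ˡ (f y) (++⁺ˡ (f x) (concat-map-↭ f p)))
concat-map-↭ f (Pm.trans p q) = ↭-trans (concat-map-↭ f p) (concat-map-↭ f q)


lit : ∀ p q → {IsT (p ≤ᵇ q)} → p ≤ q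
lit p q {t} = ≤ᵇ⇒≤ p q t

pos-∸ : ∀ {m k} → m < k → Σ ℕ (λ r → k ∸ m ≡ suc r)
pos-∸ {zero} {suc k} _ = k , refl
pos-∸ {suc m} {suc k} (s≤s h) = pos-∸ h

pred-mono-< : ∀ {i j} → 1 ≤ i → i < j → i ∸ 1 < j ∸ 1
pred-mono-< {suc i} {suc j} _ (s≤s h) = h

doubled-gap : ∀ m r K → K ≡ m + suc r → 2 * K ∸ 2 * m ∸ 2 ≡ r + r
doubled-gap m r .(m + suc r) refl rewrite *-distribˡ-+ 2 m (suc r) | m+n∸m≡n (2 * m)
    (2 * suc r) | +-identityʳ r | +-suc r r = refl


-- Counting runs

runsFrom-run : ∀ c m w → runsFrom c (run m c ++ w) ≡ runsFrom c w
runsFrom-run c zero w = refl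
runsFrom-run a (suc m) w = runsFrom-run a m w
runsFrom-run b (suc m) w = runsFrom-run b m w

-- The word w_k and its conjugate V k

-- block i is the factor a b^i a a a b^i a b a^(i-2) of w_k with its leading a moved to the end.
block : ℕ → Word
block i = run i b ++ run 3 a ++ run i b ++ run 1 a ++ run 1 b ++ run (i ∸ 1) a

final : ℕ → Word
final k = run k b ++ run 3 a

V : ℕ → Word
V k = concatFrom 2 (k ∸ 2) block ++ final k

factor : ℕ → Word
factor i = (a ∷ []) ++ ((b ∷ []) ^ i) ++ (a ∷ a ∷ []) ++ (a ∷ []) ++ ((b ∷ []) ^ i) ++ (a ∷ b ∷ []) ++
    ((a ∷ []) ^ (i ∸ 2))

factorTail : ℕ → Word
factorTail i = ((b ∷ []) ^ i) ++ (a ∷ a ∷ []) ++ (a ∷ []) ++ ((b ∷ []) ^ i) ++ (a ∷ b ∷ []) ++ ((a ∷ []) ^ (i ∸ 2))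

block≡factorTail∷ʳa : ∀ i → 2 ≤ i → block i ≡ factorTail i ++ a ∷ []
block≡factorTail∷ʳa (suc (suc i)) (s≤s (s≤s z≤n)) rewrite [c]^n≡run i b | [c]^n≡run i a =
  cong (λ z → b ∷ b ∷ z) (trans (cong (run i b ++_) (cong (λ z →
      a ∷ a ∷ a ∷ b ∷ b ∷ z) (trans (cong (run i b ++_) (cong (λ z →
      a ∷ b ∷ z) (run-∷ʳ i a))) (sym (++-assoc (run i b) (a ∷ b ∷ run i a) (a ∷ []))))))
      (sym (++-assoc (run i b) _ (a ∷ []))))

factors-rotate : ∀ lo n Z → 2 ≤ lo → concatFrom lo n factor ++ a ∷ Z ≡ a ∷ (concatFrom lo n block ++ Z)
factors-rotate lo zero Z h = refl
factors-rotate lo (suc n) Z h =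
  trans (++-assoc (factor lo) (concatFrom (suc lo) n factor) (a ∷ Z))
  (cong (a ∷_) (trans (cong (factorTail lo ++_) (factors-rotate (suc lo) n Z (m≤n⇒m≤1+n h)))
  (trans (sym (++-assoc (factorTail lo) (a ∷ []) _))
  (trans (cong (_++ (concatFrom (suc lo) n block ++ Z)) (sym (block≡factorTail∷ʳa lo h)))
  (sym (++-assoc (block lo) (concatFrom (suc lo) n block) Z))))))

prod-factors : ∀ k → 1 ≤ k → prod 2 (k ∸ 1) factor ≡ concatFrom 2 (k ∸ 2) factor
prod-factors (suc k) h = prod≡concatFrom 2 k factor

W-split : ∀ k → 1 ≤ k → W k ≡ (a ∷ []) ++ (concatFrom 2 (k ∸ 2) block ++ run k b ++ a ∷ a ∷ [])
W-split k h =
  trans (cong (λ z → (z ++ (a ∷ []) ++ ((b ∷ []) ^ k) ++ (a ∷ [])) ++ (a ∷ [])) (prod-factors k h))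
  (trans (++-assoc (concatFrom 2 (k ∸ 2) factor) _ (a ∷ []))
  (trans (factors-rotate 2 (k ∸ 2) _ ≤-refl)
  (cong (λ z → a ∷ (concatFrom 2 (k ∸ 2) block ++ z)) (trans (cong (λ z →
      (z ++ a ∷ []) ++ a ∷ []) ([c]^n≡run k b)) (++-assoc (run k b) (a ∷ []) (a ∷ []))))))

V-split : ∀ k → V k ≡ (concatFrom 2 (k ∸ 2) block ++ run k b ++ a ∷ a ∷ []) ++ (a ∷ [])
V-split k = trans (cong (concatFrom 2 (k ∸ 2) block ++_) (sym (++-assoc (run k b) (a ∷ a ∷ []) (a ∷ []))))
                  (sym (++-assoc (concatFrom 2 (k ∸ 2) block) (run k b ++ a ∷ a ∷ []) (a ∷ [])))

conjugates-W↭V : ∀ k → 1 ≤ k → conjugates (W k) ↭ conjugates (V k)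
conjugates-W↭V k h rewrite W-split k h | V-split k = conjugates-++-comm (a ∷ [])
    (concatFrom 2 (k ∸ 2) block ++ run k b ++ a ∷ a ∷ [])

blockRotations : Word → ℕ → ℕ → Word → List Word
blockRotations X lo zero Y = []
blockRotations X lo (suc n) Y = rotations X (block lo)
    (concatFrom (suc lo) n block ++ Y) ++ blockRotations (X ++ block lo) (suc lo) n Y

rotations-concatFrom-block : ∀ X lo n Y → rotations X (concatFrom lo n block) Y ≡ blockRotations X lo n Y
rotations-concatFrom-block X lo zero Y = refl
rotations-concatFrom-block X lo (suc n) Y = trans
    (rotations-++ X (block lo) (concatFrom (suc lo) n block) Y)
    (cong (rotations X (block lo) (concatFrom (suc lo) n block ++ Y) ++_)
    (rotations-concatFrom-block (X ++ block lo) (suc lo) n Y))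

blockRotations-≡ : ∀ X lo n Y (Xf : ℕ → Word) → X ≡ Xf lo → (∀ i → lo ≤ i → Xf i ++ block i ≡ Xf (suc i)) →
  blockRotations X lo n Y ≡ concatFrom lo n (λ i → rotations (Xf i) (block i) (concatFrom (suc i) (lo +
      n ∸ suc i) block ++ Y))
blockRotations-≡ X lo zero Y Xf e h = refl
blockRotations-≡ X lo (suc n) Y Xf refl h =
  cong₂ _++_ (cong (λ z → rotations (Xf lo) (block lo) (concatFrom (suc lo) z block ++ Y)) (sym (lem lo n)))
    (trans (blockRotations-≡ (Xf lo ++ block lo) (suc lo) n Y Xf (h lo ≤-refl) (λ i l → h i (<⇒≤ l)))
      (concatFrom-cong (suc lo) n (λ i _ → cong (λ z → rotations (Xf i) (block i) (concatFrom (suc i) (z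
          ∸ suc i) block ++ Y)) (sym (+-suc lo n)))))
  where
  lem : ∀ lo n → lo + suc n ∸ suc lo ≡ n
  lem zero n = refl
  lem (suc lo) n = lem lo n

tail₅ tail₄ tail₃ tail₂ tail₁ : ℕ → Word
tail₅ i = run (i ∸ 1) a
tail₄ i = run 1 b ++ tail₅ i
tail₃ i = run 1 a ++ tail₄ i
tail₂ i = run i b ++ tail₃ i
tail₁ i = run 3 a ++ tail₂ i

rotations-block : ∀ X i Y → rotations X (block i) Y ≡
  runRotations b i (tail₁ i ++ Y) X ++ runRotations a 3 (tail₂ i ++ Y)
      (X ++ run i b) ++ runRotations b i (tail₃ i ++ Y) ((X ++ run i b) ++ run 3 a) ++
  runRotations a 1 (tail₄ i ++ Y) (((X ++ run i b) ++ run 3 a) ++ run i b) ++ runRotations b 1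
      (tail₅ i ++ Y) ((((X ++ run i b) ++ run 3 a) ++ run i b) ++ run 1 a) ++
  runRotations a (i ∸ 1) Y (((((X ++ run i b) ++ run 3 a) ++ run i b) ++ run 1 a) ++ run 1 b)
rotations-block X i Y =
  trans (rotations-++ X (run i b) (tail₁ i) Y) (cong₂ _++_ (rotations-run X b i (tail₁ i ++ Y))
  (trans (rotations-++ X₂ (run 3 a) (tail₂ i) Y) (cong₂ _++_ (rotations-run X₂ a 3 (tail₂ i ++ Y))
  (trans (rotations-++ X₃ (run i b) (tail₃ i) Y) (cong₂ _++_ (rotations-run X₃ b i (tail₃ i ++ Y))
  (trans (rotations-++ X₄ (run 1 a) (tail₄ i) Y) (cong₂ _++_ (rotations-run X₄ a 1 (tail₄ i ++ Y))
  (trans (rotations-++ X₅ (run 1 b) (tail₅ i) Y)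
      (cong₂ _++_ (rotations-run X₅ b 1 (tail₅ i ++ Y)) (rotations-run X₆ a (i ∸ 1) Y))))))))))
  where
  X₂ = X ++ run i b
  X₃ = X₂ ++ run 3 a
  X₄ = X₃ ++ run i b
  X₅ = X₄ ++ run 1 a
  X₆ = X₅ ++ run 1 b

rotations-final : ∀ X k → rotations X (final k) [] ≡ runRotations b k
    (run 3 a ++ []) X ++ runRotations a 3 [] (X ++ run k b)
rotations-final X k = trans (rotations-++ X (run k b) (run 3 a) [])
    (cong₂ _++_ (rotations-run X b k (run 3 a ++ [])) (rotations-run (X ++ run k b) a 3 []))

EndsWith-block : ∀ j → 2 ≤ j → EndsWith a (block j)
EndsWith-block (suc zero) (s≤s ())
EndsWith-block (suc (suc j)) _ = EndsWith-++ (run (suc (suc j)) b)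
    (EndsWith-++ (run 3 a) (EndsWith-++ (run (suc (suc j)) b)
    (EndsWith-++ (run 1 a) (EndsWith-++ (run 1 b) (EndsWith-run j a)))))

EndsWith-concatFrom-block : ∀ lo n → 2 ≤ lo → EndsWith a (concatFrom lo (suc n) block)
EndsWith-concatFrom-block lo zero h = EndsWith-++[] (EndsWith-block lo h)
EndsWith-concatFrom-block lo (suc n) h = EndsWith-++ (block lo) (EndsWith-concatFrom-block (suc lo) n (m≤n⇒m≤1+n h))

HasPrefix-concatFrom-block : ∀ i n Z → HasPrefix (run (suc i) b ++ run 3 a) (concatFrom (suc i) (suc n) block ++ Z)
HasPrefix-concatFrom-block i n Z = (tail₂ (suc i) ++ concatFrom (suc (suc i)) n block) ++ Z ,
  trans (++-assoc (block (suc i)) (concatFrom (suc (suc i)) n block) Z)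
  (trans (++-assoc (run (suc i) b) (tail₁ (suc i)) _)
  (trans (cong (run (suc i) b ++_) (++-assoc (run 3 a) (tail₂ (suc i)) _))
  (trans (cong (λ z → run (suc i) b ++ run 3 a ++ z)
      (sym (++-assoc (tail₂ (suc i)) (concatFrom (suc (suc i)) n block) Z)))
  (sym (++-assoc (run (suc i) b) (run 3 a) _)))))

HasPrefix-final : ∀ k' j → k' ≡ suc j → HasPrefix (run (suc j) b ++ run 3 a) (final k' ++ [])
HasPrefix-final .(suc j) j refl = [] , refl

aᵉb bᵐa : ℕ → Word
aᵉb e = ((a ∷ []) ^ e) ++ (b ∷ [])
bᵐa m = ((b ∷ []) ^ m) ++ (a ∷ [])

aᵉb≡key : ∀ e → aᵉb e ≡ key a e
aᵉb≡key e = cong (_++ b ∷ []) ([c]^n≡run e a)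

bᵐa≡key : ∀ m → bᵐa m ≡ key b m
bᵐa≡key m = cong (_++ a ∷ []) ([c]^n≡run m b)

-- We set k = n + 6.  For 2 ≤ i < k, block i of V has runs b^i, a^3, b^i, a, b, a^(i-1)
-- (numbered 1 to 6), with Pre i before it and Post i after it.  Yⱼ i and Xⱼ i are the parts of
-- V after and before run j, so ρⱼ e i is the conjugate that starts e letters before the end of
-- run j.  Yꜰⱼ, Xꜰⱼ and φⱼ do the same for the runs b^k and a^3 of the final block.
module Wₖ (n : ℕ) where
  k : ℕ
  k = suc (suc (suc (suc (suc (suc n)))))

  Pre : ℕ → Word
  Pre i = concatFrom 2 (i ∸ 2) block

  Post : ℕ → Word
  Post i = concatFrom (suc i) (k ∸ suc i) block ++ (final k ++ [])

  blockConjugates : ℕ → List Word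
  blockConjugates i = rotations (Pre i) (block i) (Post i)

  finalConjugates : List Word
  finalConjugates = rotations (Pre k) (final k) []

  Pre-step : ∀ i → 2 ≤ i → Pre i ++ block i ≡ Pre (suc i)
  Pre-step (suc zero) (s≤s ())
  Pre-step (suc (suc j)) _ = sym (concatFrom-∷ʳ 2 j block)

  conjugates-V : conjugates (V k) ≡ concatFrom 2 (k ∸ 2) blockConjugates ++ finalConjugates
  conjugates-V = trans (conjugates-rotations (V k)) (trans (rotations-++ [] (concatFrom 2 (k ∸ 2) block) (final k) [])
            (cong (_++ finalConjugates) (trans (rotations-concatFrom-block [] 2 (k ∸ 2) (final k ++ []))
                (blockRotations-≡ [] 2 (k ∸ 2) (final k ++ []) Pre refl Pre-step))))

  Y₁ Y₂ Y₃ Y₄ Y₅ Y₆ X₁ X₂ X₃ X₄ X₅ X₆ : ℕ → Word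
  Y₁ i = tail₁ i ++ Post i
  Y₂ i = tail₂ i ++ Post i
  Y₃ i = tail₃ i ++ Post i
  Y₄ i = tail₄ i ++ Post i
  Y₅ i = tail₅ i ++ Post i
  Y₆ i = Post i
  X₁ i = Pre i
  X₂ i = Pre i ++ run i b
  X₃ i = X₂ i ++ run 3 a
  X₄ i = X₃ i ++ run i b
  X₅ i = X₄ i ++ run 1 a
  X₆ i = X₅ i ++ run 1 b

  Yꜰ₁ Xꜰ₁ Yꜰ₂ Xꜰ₂ : Word
  Yꜰ₁ = run 3 a ++ []
  Xꜰ₁ = Pre k
  Yꜰ₂ = []
  Xꜰ₂ = Pre k ++ run k b

  ρ₁ ρ₃ ρ₂ ρ₆ : ℕ → ℕ → Word
  ρ₁ m i = runConj b m (Y₁ i) (X₁ i) (i ∸ m)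
  ρ₃ m i = runConj b m (Y₃ i) (X₃ i) (i ∸ m)
  ρ₂ e i = runConj a e (Y₂ i) (X₂ i) (3 ∸ e)
  ρ₆ e i = runConj a e (Y₆ i) (X₆ i) (i ∸ 1 ∸ e)

  ρ₅ ρ₄ φ₁ φ₂ : ℕ → Word
  ρ₅ i = runConj b 1 (Y₅ i) (X₅ i) 0
  ρ₄ i = runConj a 1 (Y₄ i) (X₄ i) 0
  φ₁ m = runConj b m Yꜰ₁ Xꜰ₁ (k ∸ m)
  φ₂ e = runConj a e Yꜰ₂ Xꜰ₂ (3 ∸ e)

  Post-prefix : ∀ i → i < k → HasPrefix (run (suc i) b ++ run 3 a) (Post i)
  Post-prefix i lt = aux (k ∸ suc i) refl
    where
    aux : ∀ m → m ≡ k ∸ suc i → HasPrefix (run (suc i) b ++ run 3 a) (concatFrom (suc i) m block ++ (final k ++ []))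
    aux zero e = HasPrefix-final k i (≤-antisym (m∸n≡0⇒m≤n (sym e)) lt)
    aux (suc m) e = HasPrefix-concatFrom-block i m _

  EndsWith-Post : ∀ i → EndsWith a (Post i)
  EndsWith-Post i = EndsWith-++ (concatFrom (suc i) (k ∸ suc i) block)
      (EndsWith-++[] (EndsWith-++ (run k b) (EndsWith-run 2 a)))

  EndsWith-Pre : ∀ i → 3 ≤ i → EndsWith a (Pre i)
  EndsWith-Pre (suc zero) (s≤s ())
  EndsWith-Pre (suc (suc zero)) (s≤s (s≤s ()))
  EndsWith-Pre (suc (suc (suc j))) _ = EndsWith-concatFrom-block 2 j ≤-refl

  head₁ : ∀ i → HasHead a (Y₁ i ++ X₁ i)
  head₁ i = HasHead-++ (Y₁ i) (X₁ i) (_ , refl)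
  head₂ : ∀ i → 1 ≤ i → HasHead b (Y₂ i ++ X₂ i)
  head₂ (suc i) _ = HasHead-++ (Y₂ (suc i)) (X₂ (suc i)) (_ , refl)
  head₃ : ∀ i → HasHead a (Y₃ i ++ X₃ i)
  head₃ i = HasHead-++ (Y₃ i) (X₃ i) (_ , refl)
  head₄ : ∀ i → HasHead b (Y₄ i ++ X₄ i)
  head₄ i = HasHead-++ (Y₄ i) (X₄ i) (_ , refl)
  head₅ : ∀ i → 2 ≤ i → HasHead a (Y₅ i ++ X₅ i)
  head₅ (suc zero) (s≤s ())
  head₅ (suc (suc i)) _ = HasHead-++ (Y₅ (suc (suc i))) (X₅ (suc (suc i))) (_ , refl)
  head₆ : ∀ i → i < k → HasHead b (Y₆ i ++ X₆ i)
  head₆ i lt with Post-prefix i lt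
  ... | r , e = HasHead-++ (Y₆ i) (X₆ i) (_ , e)
  headꜰ₁ : HasHead a (Yꜰ₁ ++ Xꜰ₁)
  headꜰ₁ = _ , refl
  headꜰ₂ : HasHead b (Yꜰ₂ ++ Xꜰ₂)
  headꜰ₂ = _ , refl

  blockConjugates-runs : ∀ i → blockConjugates i ≡ runRotations b i (Y₁ i) (X₁ i) ++ runRotations a 3
      (Y₂ i) (X₂ i) ++ runRotations b i (Y₃ i) (X₃ i) ++ runRotations a 1 (Y₄ i)
      (X₄ i) ++ runRotations b 1 (Y₅ i) (X₅ i) ++ runRotations a (i ∸ 1) (Y₆ i) (X₆ i)
  blockConjugates-runs i = rotations-block (Pre i) i (Post i)

  filter-block-b : ∀ m i → 2 ≤ i → i < k → filter (prefix? (key b (suc m))) (blockConjugates i) ≡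
        pick b i (Y₁ i) (X₁ i) (suc m) ++ [] ++ pick b i (Y₃ i) (X₃ i) (suc m) ++ [] ++ pick b 1 (Y₅ i)
            (X₅ i) (suc m) ++ []
  filter-block-b m i h2 hk = trans (cong (filter (prefix? (key b (suc m)))) (blockConjugates-runs i))
    (filter-++⁶ (key b (suc m)) (runRotations b i (Y₁ i) (X₁ i)) (runRotations a 3 (Y₂ i) (X₂ i))
        (runRotations b i (Y₃ i) (X₃ i)) (runRotations a 1 (Y₄ i) (X₄ i))
        (runRotations b 1 (Y₅ i) (X₅ i)) (runRotations a (i ∸ 1) (Y₆ i) (X₆ i))
      (filter-runRotations b i (Y₁ i) (X₁ i) (suc m) (head₁ i) (s≤s z≤n))
      (filter-runRotations-other a 3 (Y₂ i) (X₂ i) m)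
      (filter-runRotations b i (Y₃ i) (X₃ i) (suc m) (head₃ i) (s≤s z≤n))
      (filter-runRotations-other a 1 (Y₄ i) (X₄ i) m)
      (filter-runRotations b 1 (Y₅ i) (X₅ i) (suc m) (head₅ i h2) (s≤s z≤n))
      (filter-runRotations-other a (i ∸ 1) (Y₆ i) (X₆ i) m))

  filter-block-a : ∀ e i → 2 ≤ i → i < k → filter (prefix? (key a (suc e))) (blockConjugates i) ≡
        [] ++ pick a 3 (Y₂ i) (X₂ i) (suc e) ++ [] ++ pick a 1 (Y₄ i) (X₄ i) (suc e) ++ [] ++ pick a
            (i ∸ 1) (Y₆ i) (X₆ i) (suc e)
  filter-block-a e i h2 hk = trans (cong (filter (prefix? (key a (suc e)))) (blockConjugates-runs i))
    (filter-++⁶ (key a (suc e)) (runRotations b i (Y₁ i) (X₁ i)) (runRotations a 3 (Y₂ i) (X₂ i))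
        (runRotations b i (Y₃ i) (X₃ i)) (runRotations a 1 (Y₄ i) (X₄ i))
        (runRotations b 1 (Y₅ i) (X₅ i)) (runRotations a (i ∸ 1) (Y₆ i) (X₆ i))
      (filter-runRotations-other b i (Y₁ i) (X₁ i) e)
      (filter-runRotations a 3 (Y₂ i) (X₂ i) (suc e) (head₂ i (<⇒≤ h2)) (s≤s z≤n))
      (filter-runRotations-other b i (Y₃ i) (X₃ i) e)
      (filter-runRotations a 1 (Y₄ i) (X₄ i) (suc e) (head₄ i) (s≤s z≤n))
      (filter-runRotations-other b 1 (Y₅ i) (X₅ i) e)
      (filter-runRotations a (i ∸ 1) (Y₆ i) (X₆ i) (suc e) (head₆ i hk) (s≤s z≤n)))

  finalConjugates-runs : finalConjugates ≡ runRotations b k Yꜰ₁ Xꜰ₁ ++ runRotations a 3 Yꜰ₂ Xꜰ₂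
  finalConjugates-runs = rotations-final (Pre k) k

  filter-final-b : ∀ m → filter (prefix? (key b (suc m))) finalConjugates ≡ pick b k Yꜰ₁ Xꜰ₁ (suc m) ++ []
  filter-final-b m = trans (cong (filter (prefix? (key b (suc m)))) finalConjugates-runs)
    (filter-++² (key b (suc m)) (runRotations b k Yꜰ₁ Xꜰ₁) (runRotations a 3 Yꜰ₂ Xꜰ₂)
        (filter-runRotations b k Yꜰ₁ Xꜰ₁ (suc m) headꜰ₁ (s≤s z≤n)) (filter-runRotations-other a 3 Yꜰ₂ Xꜰ₂ m))

  filter-final-a : ∀ e → filter (prefix? (key a (suc e))) finalConjugates ≡ [] ++ pick a 3 Yꜰ₂ Xꜰ₂ (suc e)
  filter-final-a e = trans (cong (filter (prefix? (key a (suc e)))) finalConjugates-runs)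
    (filter-++² (key a (suc e)) (runRotations b k Yꜰ₁ Xꜰ₁) (runRotations a 3 Yꜰ₂ Xꜰ₂)
        (filter-runRotations-other b k Yꜰ₁ Xꜰ₁ e) (filter-runRotations a 3 Yꜰ₂ Xꜰ₂ (suc e) headꜰ₂ (s≤s z≤n)))

  filter-conjugates-V : ∀ x → filter (prefix? x) (conjugates (V k)) ≡ concatFrom 2 (k ∸ 2) (λ i →
      filter (prefix? x) (blockConjugates i)) ++ filter (prefix? x) finalConjugates
  filter-conjugates-V x = trans (cong (filter (prefix? x)) conjugates-V)
      (trans (filter-++ (prefix? x) (concatFrom 2 (k ∸ 2) blockConjugates) finalConjugates)
            (cong (_++ filter (prefix? x) finalConjugates) (filter-concatFrom (prefix? x) 2 (k ∸ 2) blockConjugates)))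

  β-by-sorting : ∀ x T → Sorted T → T ↭ filter (prefix? x) (conjugates (V k)) → β x (W k) ≡ map lastL T
  β-by-sorting x T sT p = cong (map lastL)
    (filter-sortWords x (conjugates (W k)) T sT (↭-trans p (filter-↭ (prefix? x) (↭-sym (conjugates-W↭V k (s≤s z≤n))))))


  EndsWith₁ : ∀ i → 2 ≤ i → EndsWith a (Y₁ i ++ X₁ i)
  EndsWith₁ (suc zero) (s≤s ())
  EndsWith₁ (suc (suc zero)) _ = EndsWith-++[] (EndsWith-++ (tail₁ 2) (EndsWith-Post 2))
  EndsWith₁ (suc (suc (suc i))) _ = EndsWith-++ (Y₁ (3 + i)) (EndsWith-Pre (3 + i) (s≤s (s≤s (s≤s z≤n))))

  EndsWith₃ : ∀ i → EndsWith a (Y₃ i ++ X₃ i)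
  EndsWith₃ i = EndsWith-++ (Y₃ i) (EndsWith-++ (X₂ i) (EndsWith-run 2 a))


  ρ₃-prefix-a : ∀ m j → HasPrefix (run m b ++ a ∷ b ∷ (run (j ∸ 1) a ++ [])) (ρ₃ m j)
  ρ₃-prefix-a m j = HasPrefix-++ (run m b) (HasPrefix-∷ a (HasPrefix-∷ b (HasPrefix-extend _
      (HasPrefix-++ (run (j ∸ 1) a) (HasPrefix-[] _)))))

  ρ₃-prefix-b : ∀ m i → i < k → HasPrefix (run m b ++ a ∷ b ∷ (run (i ∸ 1) a ++ b ∷ [])) (ρ₃ m i)
  ρ₃-prefix-b m i lt = HasPrefix-++ (run m b) (HasPrefix-∷ a (HasPrefix-∷ b (HasPrefix-extend _
      (HasPrefix-++ (run (i ∸ 1) a)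
                   (HasPrefix-truncate (b ∷ []) (run i b ++ run 3 a) (Post-prefix i lt))))))

  inRange⇒<k : ∀ {lo cnt i} → lo + cnt ≤ k → InRange lo cnt i → i < k
  inRange⇒<k h (_ , lt) = ≤-trans lt h

  AllPairs-ρ₃ : ∀ m lo cnt → 1 ≤ lo → lo + cnt ≤ k → AllPairs _≺_ (concatFromRev lo cnt (λ i → ρ₃ m i ∷ []))
  AllPairs-ρ₃ m lo cnt h1 hk = concatFromRev-AllPairs lo cnt _ (λ i _ → AllPairs-single _)
           (λ i j ri rj lt → (HasPrefix-≺ (++-≺ (run m b) (≺-there (≺-there (aᵐ≺aⁿb (j ∸ 1) (i ∸ 1)
               (pred-mono-< (≤-trans h1 (proj₁ ri)) lt)))))
                                (ρ₃-prefix-a m j) (ρ₃-prefix-b m i (inRange⇒<k hk ri)) ∷ []) ∷ [])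

  tail₂-prefix : ∀ i Z → HasPrefix (trailKey (rank-ab i)) (tail₂ i ++ Z)
  tail₂-prefix i Z = subst (λ K → HasPrefix K (tail₂ i ++ Z)) (sym (trailKey-ab i))
     (HasPrefix-extend Z (HasPrefix-++ (run i b) (HasPrefix-∷ a (HasPrefix-∷ b (HasPrefix-[] (tail₅ i))))))

  EndsWithꜰ₁ : EndsWith a (Yꜰ₁ ++ Xꜰ₁)
  EndsWithꜰ₁ = EndsWith-++ Yꜰ₁ (EndsWith-concatFrom-block 2 (3 + n) ≤-refl)

  module Class-bᵏa where
   filter-block : ∀ i → 2 ≤ i → i < k → filter (prefix? (key b k)) (blockConjugates i) ≡ []
   filter-block i h2 lt with filter-block-b (5 + n) i h2 lt
   ... | e rewrite pick-miss b i (Y₁ i) (X₁ i) k lt | pick-miss b i (Y₃ i) (X₃ i) k lt | pick-miss b 1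
       (Y₅ i) (X₅ i) k (s≤s (s≤s z≤n)) = e

   filter-final : filter (prefix? (key b k)) finalConjugates ≡ φ₁ k ∷ []
   filter-final with filter-final-b (5 + n)
   ... | e rewrite pick-hit b k Yꜰ₁ Xꜰ₁ k ≤-refl = e

   filter-conjugates : filter (prefix? (key b k)) (conjugates (V k)) ≡ φ₁ k ∷ []
   filter-conjugates = trans (filter-conjugates-V (key b k))
       (cong₂ _++_ (concatFrom-[] 2 (k ∸ 2) _ (λ i ir → filter-block i (proj₁ ir) (proj₂ ir))) filter-final)

   lastL-φ₁ : lastL (φ₁ k) ≡ a
   lastL-φ₁ rewrite n∸n≡0 n = runConj-lastL-0 b a k Yꜰ₁ Xꜰ₁ EndsWithꜰ₁

   β-value : β (key b k) (W k) ≡ a ∷ []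
   β-value = trans (β-by-sorting (key b k) (φ₁ k ∷ []) (AllPairs-single _)
       (↭-reflexive (sym filter-conjugates))) (cong (_∷ []) lastL-φ₁)

  module Class-bᵐa (m′ : ℕ) (2≤m : 2 ≤ suc m′) (m<k : suc m′ < k) where
   m : ℕ
   m = suc m′

   gap : ℕ
   gap = proj₁ (pos-∸ m<k)
   k∸m≡1+gap : k ∸ m ≡ suc gap
   k∸m≡1+gap = proj₂ (pos-∸ m<k)

   filter-block-below : ∀ i → 2 ≤ i → i < m → filter (prefix? (key b m)) (blockConjugates i) ≡ []
   filter-block-below i h2 lt with filter-block-b m′ i h2 (≤-trans lt (<⇒≤ m<k))
   ... | e rewrite pick-miss b i (Y₁ i) (X₁ i) m lt | pick-miss b i (Y₃ i) (X₃ i) m lt | pick-miss b 1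
       (Y₅ i) (X₅ i) m 2≤m = e

   filter-block-above : ∀ i → m ≤ i → i < k → filter (prefix? (key b m)) (blockConjugates i) ≡ ρ₁ m i ∷ ρ₃ m i ∷ []
   filter-block-above i le lt with filter-block-b m′ i (≤-trans 2≤m le) lt
   ... | e rewrite pick-hit b i (Y₁ i) (X₁ i) m le | pick-hit b i (Y₃ i) (X₃ i) m le | pick-miss b 1
       (Y₅ i) (X₅ i) m 2≤m = e

   filter-final : filter (prefix? (key b m)) finalConjugates ≡ φ₁ m ∷ []
   filter-final with filter-final-b m′
   ... | e rewrite pick-hit b k Yꜰ₁ Xꜰ₁ m (<⇒≤ m<k) = e

   filter-conjugates : filter (prefix? (key b m)) (conjugates (V k)) ≡ concatFrom m (k ∸ m) (λ i →
       ρ₁ m i ∷ ρ₃ m i ∷ []) ++ φ₁ m ∷ []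
   filter-conjugates = trans (filter-conjugates-V (key b m)) (cong₂ _++_
          (trans (concatFrom-split 2 m k _ 2≤m (<⇒≤ m<k))
            (cong₂ _++_ (concatFrom-[] 2 (m ∸ 2) _ (λ i ir → filter-block-below i (proj₁ ir) (inRange⇒< 2≤m ir)))
                        (concatFrom-cong m (k ∸ m) (λ i ir →
                            filter-block-above i (proj₁ ir) (inRange⇒< (<⇒≤ m<k) ir)))))
          filter-final)

   ordered : List Word
   ordered = φ₁ m ∷ (concatFrom m (k ∸ m) (λ i → ρ₁ m i ∷ []) ++ concatFromRev m (k ∸ m) (λ i → ρ₃ m i ∷ []))

   ordered-↭ : ordered ↭ filter (prefix? (key b m)) (conjugates (V k))
   ordered-↭ = ↭-trans (↭-prep (φ₁ m) (++⁺ˡ (concatFrom m (k ∸ m) (λ i →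
       ρ₁ m i ∷ [])) (concatFromRev-↭ m (k ∸ m) (λ i → ρ₃ m i ∷ []))))
         (↭-trans (↭-prep (φ₁ m) (↭-sym (concatFrom-unzip m (k ∸ m) (λ i → ρ₁ m i ∷ []) (λ i → ρ₃ m i ∷ []))))
         (↭-trans (++-comm (φ₁ m ∷ []) (concatFrom m (k ∸ m) (λ i → ρ₁ m i ∷ ρ₃ m i ∷ [])))
         (↭-reflexive (sym filter-conjugates))))

   κ : ℕ → Word
   κ q = run m b ++ a ∷ a ∷ a ∷ trailKey q

   open RankedBy κ (rank-ab k) (λ h _ → ++-≺ (run m b) (≺-there (≺-there (≺-there (trailKey-mono h)))))

   φ₁-prefix : HasPrefix (κ (rank-aa 2)) (φ₁ m)
   φ₁-prefix = HasPrefix-++ (run m b) (HasPrefix-∷ a (HasPrefix-∷ a (HasPrefix-∷ a (_ , refl))))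

   ρ₁-prefix : ∀ i → HasPrefix (κ (rank-ab i)) (ρ₁ m i)
   ρ₁-prefix i = HasPrefix-++ (run m b) (HasPrefix-∷ a (HasPrefix-∷ a (HasPrefix-∷ a (HasPrefix-extend _
       (tail₂-prefix i (Post i))))))

   4<rank-ab-m : 4 < rank-ab m
   4<rank-ab-m = s≤s (dbl-≤ 2≤m)

   ranked-φ₁-ρ₁ : Ranked (rank-aa 2) (rank-ab k) (φ₁ m ∷ concatFrom m (k ∸ m) (λ i → ρ₁ m i ∷ []))
   ranked-φ₁-ρ₁ = Ranked-++ {L1 = φ₁ m ∷ []} (<⇒≤ 4<rank-ab-m) (rank-ab-mono (<⇒≤ m<k)) ≤-refl
           (Ranked-single (rank-aa 2) (φ₁ m) ≤-refl 4<rank-ab-m φ₁-prefix)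
           (subst (λ z → Ranked (rank-ab m) (rank-ab z) (concatFrom m (k ∸ m) (λ i →
               ρ₁ m i ∷ []))) (m+[n∸m]≡n (<⇒≤ m<k))
             (Ranked-concatFrom rank-ab m (k ∸ m) (λ i → ρ₁ m i ∷ []) (subst (λ z →
                 rank-ab z ≤ rank-ab k) (sym (m+[n∸m]≡n (<⇒≤ m<k))) ≤-refl) rank-ab-step
               (λ i ir → Ranked-single (rank-ab i) (ρ₁ m i) ≤-refl (rank-ab-< i) (ρ₁-prefix i))))

   key-aa key-ab : Word
   key-aa = run m b ++ a ∷ a ∷ []
   key-ab = run m b ++ a ∷ b ∷ []

   ρ₃-prefix-ab : ∀ i → HasPrefix key-ab (ρ₃ m i)
   ρ₃-prefix-ab i = HasPrefix-++ (run m b) (HasPrefix-∷ a (HasPrefix-∷ b (HasPrefix-[] _)))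

   allPairs-ρ₃ : AllPairs _≺_ (concatFromRev m (k ∸ m) (λ i → ρ₃ m i ∷ []))
   allPairs-ρ₃ = AllPairs-ρ₃ m m (k ∸ m) (s≤s z≤n) (≤-reflexive (m+[n∸m]≡n (<⇒≤ m<k)))

   ordered-sorted : Sorted ordered
   ordered-sorted = AllPairs≺⇒Sorted (AllPairs-++-keyed {L1 = φ₁ m ∷ concatFrom m (k ∸ m) (λ i →
       ρ₁ m i ∷ [])} {K1 = key-aa} {K2 = key-ab}
      (Ranked⇒AllPairs ranked-φ₁-ρ₁) allPairs-ρ₃
      (All.map (λ { (q , _ , _ , hp) → HasPrefix-shorten (run m b) (a ∷ a ∷ []) (a ∷ trailKey q) hp })
          (proj₂ ranked-φ₁-ρ₁))
      (concatFromRev-All m (k ∸ m) _ (λ i _ → ρ₃-prefix-ab i ∷ []))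
      (++-≺ (run m b) (≺-there ≺-here)))

   lastL-ρ₁ : lastL (ρ₁ m m) ≡ a
   lastL-ρ₁ rewrite n∸n≡0 m = runConj-lastL-0 b a m (Y₁ m) (X₁ m) (EndsWith₁ m 2≤m)

   lastL-ρ₃ : lastL (ρ₃ m m) ≡ a
   lastL-ρ₃ rewrite n∸n≡0 m = runConj-lastL-0 b a m (Y₃ m) (X₃ m) (EndsWith₃ m)

   lastL-ordered : map lastL ordered ≡ b ∷ a ∷ (run (gap + gap) b ++ a ∷ [])
   lastL-ordered = cong₂ _∷_ (runConj-lastL-pos b m Yꜰ₁ Xꜰ₁ (k ∸ m) (subst (1 ≤_) (sym k∸m≡1+gap) (s≤s z≤n)))
     (trans (map-++ lastL (concatFrom m (k ∸ m) (λ i → ρ₁ m i ∷ [])) _)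
     (trans (cong₂ _++_ (map-concatFrom lastL m (k ∸ m) (λ i →
         ρ₁ m i ∷ [])) (map-concatFromRev lastL m (k ∸ m) (λ i → ρ₃ m i ∷ [])))
     (trans (cong (λ z → concatFrom m z (λ i → lastL (ρ₁ m i) ∷ []) ++ concatFromRev m z (λ i →
         lastL (ρ₃ m i) ∷ [])) k∸m≡1+gap)
     (trans (cong₂ (λ u v → (u ∷ concatFrom (suc m) gap (λ i →
         lastL (ρ₁ m i) ∷ [])) ++ (concatFromRev (suc m) gap (λ i →
         lastL (ρ₃ m i) ∷ []) ++ v ∷ [])) lastL-ρ₁ lastL-ρ₃)
     (trans (cong₂ (λ u v → (a ∷ u) ++ (v ++ a ∷ []))
               (trans (concatFrom-cong (suc m) gap (λ i ir →
                   cong (_∷ []) (runConj-lastL-pos b m (Y₁ i) (X₁ i) (i ∸ m) (m<n⇒0<n∸m (proj₁ ir)))))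
                   (concatFrom-const (suc m) gap b))
               (trans (concatFromRev-cong (suc m) gap (λ i ir →
                   cong (_∷ []) (runConj-lastL-pos b m (Y₃ i) (X₃ i) (i ∸ m) (m<n⇒0<n∸m (proj₁ ir)))))
                   (concatFromRev-const (suc m) gap b)))
     (cong (a ∷_) (trans (sym (++-assoc (run gap b) (run gap b) (a ∷ []))) (cong (_++ a ∷ []) (run-++ gap gap b)))))))))

   β-value : β (key b m) (W k) ≡ b ∷ a ∷ (run (gap + gap) b ++ a ∷ [])
   β-value = trans (β-by-sorting (key b m) ordered ordered-sorted ordered-↭) lastL-ordered

   m+1+gap≡k : m + suc gap ≡ k
   m+1+gap≡k = trans (cong (m +_) (sym k∸m≡1+gap)) (m+[n∸m]≡n (<⇒≤ m<k))

  module Class-ba where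
   filter-block : ∀ i → 2 ≤ i → i < k → filter (prefix? (key b 1)) (blockConjugates i) ≡ ρ₁ 1 i ∷ ρ₃ 1 i ∷ ρ₅ i ∷ []
   filter-block i h2 lt with filter-block-b 0 i h2 lt
   ... | e rewrite pick-hit b i (Y₁ i) (X₁ i) 1 (≤-trans (s≤s z≤n) h2) | pick-hit b i (Y₃ i) (X₃ i) 1
       (≤-trans (s≤s z≤n) h2) | pick-hit b 1 (Y₅ i) (X₅ i) 1 ≤-refl = e

   filter-final : filter (prefix? (key b 1)) finalConjugates ≡ φ₁ 1 ∷ []
   filter-final with filter-final-b 0
   ... | e rewrite pick-hit b k Yꜰ₁ Xꜰ₁ 1 (s≤s z≤n) = e

   filter-conjugates : filter (prefix? (key b 1)) (conjugates (V k)) ≡ concatFrom 2 (k ∸ 2) (λ i →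
       ρ₁ 1 i ∷ ρ₃ 1 i ∷ ρ₅ i ∷ []) ++ φ₁ 1 ∷ []
   filter-conjugates = trans (filter-conjugates-V (key b 1))
       (cong₂ _++_ (concatFrom-cong 2 (k ∸ 2) (λ i ir → filter-block i (proj₁ ir) (proj₂ ir))) filter-final)

   [ρ₁] [ρ₃] [ρ₅] : ℕ → List Word
   [ρ₁] i = ρ₁ 1 i ∷ []
   [ρ₃] i = ρ₃ 1 i ∷ []
   [ρ₅] i = ρ₅ i ∷ []

   piece : ℕ → List Word
   piece 0 = concatFrom 5 (k ∸ 5) [ρ₅]
   piece 1 = φ₁ 1 ∷ []
   piece 2 = ρ₁ 1 2 ∷ []
   piece 3 = ρ₁ 1 3 ∷ []
   piece 4 = ρ₁ 1 4 ∷ []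
   piece 5 = ρ₅ 4 ∷ []
   piece 6 = concatFrom 5 (k ∸ 5) [ρ₁]
   piece 7 = ρ₅ 3 ∷ []
   piece 8 = concatFrom 2 (k ∸ 2) [ρ₃]
   piece 9 = ρ₅ 2 ∷ []
   piece _ = []

   part₀ part₁ part₂ part₃ part₄ ordered : List Word
   part₀ = concatFromRev 5 (k ∸ 5) [ρ₅]
   part₁ = φ₁ 1 ∷ ρ₁ 1 2 ∷ ρ₁ 1 3 ∷ ρ₁ 1 4 ∷ ρ₅ 4 ∷ concatFrom 5 (k ∸ 5) [ρ₁]
   part₂ = ρ₅ 3 ∷ []
   part₃ = concatFromRev 2 (k ∸ 2) [ρ₃]
   part₄ = ρ₅ 2 ∷ []
   ordered = part₀ ++ (part₁ ++ (part₂ ++ (part₃ ++ part₄)))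

   pieceOrder pieceOrderV : List ℕ
   pieceOrder = 0 ∷ 1 ∷ 2 ∷ 3 ∷ 4 ∷ 5 ∷ 6 ∷ 7 ∷ 8 ∷ 9 ∷ []
   pieceOrderV = 2 ∷ 3 ∷ 4 ∷ 6 ∷ 8 ∷ 9 ∷ 7 ∷ 5 ∷ 0 ∷ 1 ∷ []

   ordered↭pieces : ordered ↭ concat (map piece pieceOrder)
   ordered↭pieces = ++⁺ (concatFromRev-↭ 5 (k ∸ 5) [ρ₅])
       (++⁺ˡ (φ₁ 1 ∷ ρ₁ 1 2 ∷ ρ₁ 1 3 ∷ ρ₁ 1 4 ∷ ρ₅ 4 ∷ []) (++⁺ˡ (concatFrom 5 (k ∸ 5) [ρ₁])
             (++⁺ˡ (ρ₅ 3 ∷ []) (++⁺ʳ (ρ₅ 2 ∷ []) (concatFromRev-↭ 2 (k ∸ 2) [ρ₃])))))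

   filter↭pieces : concatFrom 2 (k ∸ 2) (λ i → ρ₁ 1 i ∷ ρ₃ 1 i ∷ ρ₅ i ∷ []) ++ φ₁ 1 ∷ []
       ↭ concat (map piece pieceOrderV)
   filter↭pieces = ↭-trans (++⁺ʳ (φ₁ 1 ∷ []) (concatFrom-unzip 2 (k ∸ 2) [ρ₁] (λ i → ρ₃ 1 i ∷ ρ₅ i ∷ [])))
            (↭-trans (++⁺ʳ (φ₁ 1 ∷ []) (++⁺ˡ (concatFrom 2 (k ∸ 2) [ρ₁]) (concatFrom-unzip 2 (k ∸ 2) [ρ₃] [ρ₅])))
            (↭-reflexive (trans (++-assoc (concatFrom 2 (k ∸ 2) [ρ₁]) _ (φ₁ 1 ∷ []))
               (cong (concatFrom 2 (k ∸ 2) [ρ₁] ++_)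
                   (++-assoc (concatFrom 2 (k ∸ 2) [ρ₃]) (concatFrom 2 (k ∸ 2) [ρ₅]) (φ₁ 1 ∷ []))))))

   ordered-↭ : ordered ↭ filter (prefix? (key b 1)) (conjugates (V k))
   ordered-↭ = ↭-trans ordered↭pieces (↭-trans (concat-map-↭ piece (sortℕ-≡⇒↭ pieceOrder pieceOrderV
       refl)) (↭-trans (↭-sym filter↭pieces) (↭-reflexive (sym filter-conjugates))))

   -- Members of the class are sorted by the outerKey they begin with, and those beginning
   -- with outerKey 1 = baaab further by the innerKey they begin with.
   outerKey : ℕ → Word
   outerKey 0 = b ∷ a ∷ a ∷ a ∷ a ∷ []
   outerKey 1 = b ∷ a ∷ a ∷ a ∷ b ∷ []
   outerKey 2 = b ∷ a ∷ a ∷ b ∷ []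
   outerKey 3 = b ∷ a ∷ b ∷ a ∷ []
   outerKey _ = b ∷ a ∷ b ∷ b ∷ []

   outerKey-adjacent : ∀ q → suc q < 5 → outerKey q ≺ outerKey (suc q)
   outerKey-adjacent 0 _ = ≺-there (≺-there (≺-there (≺-there ≺-here)))
   outerKey-adjacent 1 _ = ≺-there (≺-there (≺-there ≺-here))
   outerKey-adjacent 2 _ = ≺-there (≺-there ≺-here)
   outerKey-adjacent 3 _ = ≺-there (≺-there (≺-there ≺-here))
   outerKey-adjacent (suc (suc (suc (suc q)))) (s≤s (s≤s (s≤s (s≤s (s≤s ())))))

   module Outer = RankedBy outerKey 5 (adjacent⇒monotone outerKey 5 outerKey-adjacent)

   innerKey : ℕ → Word
   innerKey q = b ∷ a ∷ a ∷ a ∷ trailKey q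

   module Inner = RankedBy innerKey (rank-ab k) (λ h _ → ≺-there (≺-there (≺-there (≺-there (trailKey-mono h)))))

   rankedAt : ∀ j {P} → AllPairs _≺_ P → All (HasPrefix (outerKey j)) P → Outer.Ranked j (suc j) P
   rankedAt j ap hs = ap , All.map (λ hp → j , ≤-refl , ≤-refl , hp) hs


   ρ₅-prefix-a : ∀ j → HasPrefix (b ∷ (run (j ∸ 1) a ++ [])) (ρ₅ j)
   ρ₅-prefix-a j = HasPrefix-∷ b (HasPrefix-extend _ (HasPrefix-++ (run (j ∸ 1) a) (HasPrefix-[] _)))

   ρ₅-prefix-b : ∀ i → i < k → HasPrefix (b ∷ (run (i ∸ 1) a ++ b ∷ [])) (ρ₅ i)
   ρ₅-prefix-b i lt = HasPrefix-∷ b (HasPrefix-extend _ (HasPrefix-++ (run (i ∸ 1) a)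
       (HasPrefix-truncate (b ∷ []) (run i b ++ run 3 a) (Post-prefix i lt))))

   ρ₅-prefix-baaaa : ∀ i → 5 ≤ i → HasPrefix (outerKey 0) (ρ₅ i)
   ρ₅-prefix-baaaa (suc zero) (s≤s ())
   ρ₅-prefix-baaaa (suc (suc zero)) (s≤s (s≤s ()))
   ρ₅-prefix-baaaa (suc (suc (suc zero))) (s≤s (s≤s (s≤s ())))
   ρ₅-prefix-baaaa (suc (suc (suc (suc zero)))) (s≤s (s≤s (s≤s (s≤s ()))))
   ρ₅-prefix-baaaa (suc (suc (suc (suc (suc i))))) _ = HasPrefix-∷ b
       (HasPrefix-∷ a (HasPrefix-∷ a (HasPrefix-∷ a (HasPrefix-∷ a (HasPrefix-[] _)))))

   allPairs-part₀ : AllPairs _≺_ part₀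
   allPairs-part₀ = concatFromRev-AllPairs 5 (k ∸ 5) _ (λ i _ → AllPairs-single _)
           (λ i j ri rj lt → (HasPrefix-≺ (≺-there (aᵐ≺aⁿb (j ∸ 1) (i ∸ 1) (pred-mono-< (≤-trans (s≤s
               z≤n) (proj₁ ri)) lt)))
                                (ρ₅-prefix-a j) (ρ₅-prefix-b i (inRange⇒<k ≤-refl ri)) ∷ []) ∷ [])

   ranked₀ : Outer.Ranked 0 1 part₀
   ranked₀ = rankedAt 0 allPairs-part₀ (concatFromRev-All 5 (k ∸ 5) [ρ₅] (λ i ir → ρ₅-prefix-baaaa i (proj₁ ir) ∷ []))

   φ₁-innerPrefix : HasPrefix (innerKey (rank-aa 2)) (φ₁ 1)
   φ₁-innerPrefix = HasPrefix-∷ b (HasPrefix-∷ a (HasPrefix-∷ a (HasPrefix-∷ a (_ , refl))))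

   ρ₁-innerPrefix : ∀ i → HasPrefix (innerKey (rank-ab i)) (ρ₁ 1 i)
   ρ₁-innerPrefix i = HasPrefix-∷ b (HasPrefix-∷ a (HasPrefix-∷ a (HasPrefix-∷ a (HasPrefix-extend _
       (tail₂-prefix i (Post i))))))

   ρ₅-innerPrefix : HasPrefix (innerKey (rank-aa 5)) (ρ₅ 4)
   ρ₅-innerPrefix = HasPrefix-∷ b (HasPrefix-∷ a (HasPrefix-∷ a (HasPrefix-∷ a (HasPrefix-extend _
       (HasPrefix-shorten (run 5 b) (a ∷ a ∷ []) (a ∷ []) (Post-prefix 4 (lit 5 k)))))))

   ranked-inner : Inner.Ranked 4 (rank-ab k) part₁
   ranked-inner = Inner.Ranked-++ {L1 = φ₁ 1 ∷ []} (lit 4 5) (lit 5 (rank-ab k)) ≤-refl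
       (Inner.Ranked-single 4 (φ₁ 1) ≤-refl (lit 5 5) φ₁-innerPrefix)
        (Inner.Ranked-++ {L1 = ρ₁ 1 2 ∷ []} (lit 5 7) (lit 7 (rank-ab k)) ≤-refl
            (Inner.Ranked-single 5 (ρ₁ 1 2) ≤-refl (lit 6 7) (ρ₁-innerPrefix 2))
        (Inner.Ranked-++ {L1 = ρ₁ 1 3 ∷ []} (lit 7 9) (lit 9 (rank-ab k)) ≤-refl
            (Inner.Ranked-single 7 (ρ₁ 1 3) ≤-refl (lit 8 9) (ρ₁-innerPrefix 3))
        (Inner.Ranked-++ {L1 = ρ₁ 1 4 ∷ []} (lit 9 10) (lit 10 (rank-ab k)) ≤-refl
            (Inner.Ranked-single 9 (ρ₁ 1 4) ≤-refl (lit 10 10) (ρ₁-innerPrefix 4))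
        (Inner.Ranked-++ {L1 = ρ₅ 4 ∷ []} (lit 10 11) (lit 11 (rank-ab k)) ≤-refl
            (Inner.Ranked-single 10 (ρ₅ 4) ≤-refl (lit 11 11) ρ₅-innerPrefix)
        (Inner.Ranked-concatFrom rank-ab 5 (k ∸ 5) [ρ₁] ≤-refl rank-ab-step (λ i ir →
            Inner.Ranked-single (rank-ab i) (ρ₁ 1 i) ≤-refl (rank-ab-< i) (ρ₁-innerPrefix i)))))))

   innerKey⇒outerKey₁ : ∀ {u} q → 2 ≤ q → HasPrefix (innerKey q) u → HasPrefix (outerKey 1) u
   innerKey⇒outerKey₁ (suc zero) (s≤s ()) hp
   innerKey⇒outerKey₁ (suc (suc q)) _ hp = HasPrefix-shorten [] (outerKey 1) (trailKey q) hp

   ranked₁ : Outer.Ranked 1 2 part₁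
   ranked₁ = rankedAt 1 (Inner.Ranked⇒AllPairs ranked-inner) (All.map (λ { (q , lq , _ , hp) →
       innerKey⇒outerKey₁ q (≤-trans (lit 2 4) lq) hp }) (proj₂ ranked-inner))

   ranked₂ : Outer.Ranked 2 3 part₂
   ranked₂ = rankedAt 2 (AllPairs-single _) (HasPrefix-∷ b (HasPrefix-∷ a (HasPrefix-∷ a
       (HasPrefix-extend _ (HasPrefix-truncate (b ∷ []) (run 3 b ++ run 3 a) (Post-prefix 3 (lit 4 k)))))) ∷ [])

   ρ₃-prefix-baba : ∀ i → 2 ≤ i → HasPrefix (outerKey 3) (ρ₃ 1 i)
   ρ₃-prefix-baba (suc zero) (s≤s ())
   ρ₃-prefix-baba (suc (suc i)) _ = HasPrefix-∷ b (HasPrefix-∷ a (HasPrefix-∷ b (HasPrefix-∷ a (HasPrefix-[] _))))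

   ranked₃ : Outer.Ranked 3 4 part₃
   ranked₃ = rankedAt 3 (AllPairs-ρ₃ 1 2 (k ∸ 2) (s≤s z≤n) ≤-refl)
       (concatFromRev-All 2 (k ∸ 2) [ρ₃] (λ i ir → ρ₃-prefix-baba i (proj₁ ir) ∷ []))

   ranked₄ : Outer.Ranked 4 5 part₄
   ranked₄ = rankedAt 4 (AllPairs-single _) (HasPrefix-∷ b (HasPrefix-∷ a (HasPrefix-extend _
       (HasPrefix-truncate (b ∷ b ∷ []) (run 1 b ++ run 3 a) (Post-prefix 2 (lit 3 k))))) ∷ [])

   ordered-sorted : Sorted ordered
   ordered-sorted = AllPairs≺⇒Sorted (Outer.Ranked⇒AllPairs (Outer.Ranked-++ {L1 = part₀} (lit 0 1) (lit
       1 5) ≤-refl ranked₀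
                          (Outer.Ranked-++ {L1 = part₁} (lit 1 2) (lit 2 5) ≤-refl ranked₁
                          (Outer.Ranked-++ {L1 = part₂} (lit 2 3) (lit 3 5) ≤-refl ranked₂
                          (Outer.Ranked-++ {L1 = part₃} (lit 3 4) (lit 4 5) ≤-refl ranked₃ ranked₄)))))

   lastL-ρ₅ : ∀ i → lastL (ρ₅ i) ≡ a
   lastL-ρ₅ i = runConj-lastL-0 b a 1 (Y₅ i) (X₅ i) (EndsWith-++ (Y₅ i) (EndsWith-++ (X₄ i) (EndsWith-run 0 a)))


   lastL-ordered : map lastL ordered ≡ run (suc n) a ++
       (b ∷ b ∷ b ∷ b ∷ a ∷ (run (suc n) b ++ (a ∷ (run (4 + n) b ++ a ∷ []))))
   lastL-ordered = trans (map-++ lastL part₀ _) (cong₂ _++_ lastL-part₀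
           (trans (map-++ lastL part₁ _) (cong₂ _++_ lastL-part₁
           (cong₂ _∷_ (lastL-ρ₅ 3) (trans (map-++ lastL part₃ _)
               (cong₂ _++_ lastL-part₃ (cong (_∷ []) (lastL-ρ₅ 2))))))))
     where
     lastL-part₀ : map lastL part₀ ≡ run (suc n) a
     lastL-part₀ = trans (map-concatFromRev lastL 5 (k ∸ 5) [ρ₅])
         (trans (concatFromRev-cong 5 (k ∸ 5) (λ i ir → cong (_∷ []) (lastL-ρ₅ i)))
         (concatFromRev-const 5 (k ∸ 5) a))
     lastL-part₁ : map lastL part₁ ≡ b ∷ b ∷ b ∷ b ∷ a ∷ run (suc n) b
     lastL-part₁ = cong₂ _∷_ (runConj-lastL-pos b 1 Yꜰ₁ Xꜰ₁ (k ∸ 1) (s≤s z≤n))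
           (cong₂ _∷_ (runConj-lastL-pos b 1 (Y₁ 2) (X₁ 2) 1 (s≤s z≤n))
           (cong₂ _∷_ (runConj-lastL-pos b 1 (Y₁ 3) (X₁ 3) 2 (s≤s z≤n))
           (cong₂ _∷_ (runConj-lastL-pos b 1 (Y₁ 4) (X₁ 4) 3 (s≤s z≤n))
           (cong₂ _∷_ (lastL-ρ₅ 4)
           (trans (map-concatFrom lastL 5 (k ∸ 5) [ρ₁]) (trans (concatFrom-cong 5 (k ∸ 5) (λ i ir →
               cong (_∷ []) (runConj-lastL-pos b 1 (Y₁ i) (X₁ i) (i ∸ 1)
               (m<n⇒0<n∸m (≤-trans (lit 2 5) (proj₁ ir)))))) (concatFrom-const 5 (k ∸ 5) b)))))))
     lastL-part₃ : map lastL part₃ ≡ run (4 + n) b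
     lastL-part₃ = trans (map-concatFromRev lastL 2 (k ∸ 2) [ρ₃])
         (trans (concatFromRev-cong 2 (k ∸ 2) (λ i ir → cong (_∷ []) (runConj-lastL-pos b 1 (Y₃ i) (X₃
         i) (i ∸ 1) (m<n⇒0<n∸m (proj₁ ir))))) (concatFromRev-const 2 (k ∸ 2) b))

   β-value : β (key b 1) (W k) ≡ run (suc n) a ++
       (b ∷ b ∷ b ∷ b ∷ a ∷ (run (suc n) b ++ (a ∷ (run (4 + n) b ++ a ∷ []))))
   β-value = trans (β-by-sorting (key b 1) ordered ordered-sorted ordered-↭) lastL-ordered


  ρ₂-prefix : ∀ e i → HasPrefix (run e a ++ trailKey (rank-ab i)) (ρ₂ e i)
  ρ₂-prefix e i = HasPrefix-++ (run e a) (HasPrefix-extend _ (tail₂-prefix i (Post i)))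

  ρ₆-prefix : ∀ e i → i < k → HasPrefix (run e a ++ trailKey (rank-aa (suc i))) (ρ₆ e i)
  ρ₆-prefix e i lt = HasPrefix-++ (run e a) (HasPrefix-extend _ (subst (λ K →
      HasPrefix K (Post i)) (sym (trailKey-aa (suc i)))
                 (HasPrefix-shorten (run (suc i) b) (a ∷ a ∷ []) (a ∷ []) (Post-prefix i lt))))

  φ₂-prefix : ∀ e → HasPrefix (run e a ++ trailKey (rank-aa 2)) (φ₂ e)
  φ₂-prefix e = HasPrefix-++ (run e a) (_ , refl)

  EndsWith₂ : ∀ i → 1 ≤ i → EndsWith b (Y₂ i ++ X₂ i)
  EndsWith₂ (suc i) _ = EndsWith-++ (Y₂ (suc i)) (EndsWith-++ (Pre (suc i)) (EndsWith-run i b))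

  EndsWith₄ : ∀ i → 1 ≤ i → EndsWith b (Y₄ i ++ X₄ i)
  EndsWith₄ (suc i) _ = EndsWith-++ (Y₄ (suc i)) (EndsWith-++ (X₃ (suc i)) (EndsWith-run i b))

  EndsWith₆ : ∀ i → EndsWith b (Y₆ i ++ X₆ i)
  EndsWith₆ i = EndsWith-++ (Y₆ i) (EndsWith-++ (X₅ i) (EndsWith-run 0 b))

  EndsWithꜰ₂ : EndsWith b (Yꜰ₂ ++ Xꜰ₂)
  EndsWithꜰ₂ = EndsWith-++ (Pre k) (EndsWith-run (5 + n) b)

  module RankedAfter-aᵉ (e : ℕ) where
   κ : ℕ → Word
   κ q = run e a ++ trailKey q
   open RankedBy κ (rank-ab k) (λ h _ → ++-≺ (run e a) (trailKey-mono h)) public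

   ranked-ρ₂-ρ₆ : ∀ i → i < k → Ranked (rank-ab i) (rank-ab (suc i)) (ρ₂ e i ∷ ρ₆ e i ∷ [])
   ranked-ρ₂-ρ₆ i lt = Ranked-++ {L1 = ρ₂ e i ∷ []} (n≤1+n _) (n≤1+n _) (rank-ab-mono lt)
                (Ranked-single (rank-ab i) (ρ₂ e i) ≤-refl ≤-refl (ρ₂-prefix e i))
                (Ranked-single (rank-aa (suc i)) (ρ₆ e i) ≤-refl ≤-refl (ρ₆-prefix e i lt))

   ranked-blocks : ∀ lo → 2 ≤ lo → lo ≤ k → Ranked (rank-ab lo) (rank-ab k)
       (concatFrom lo (k ∸ lo) (λ i → ρ₂ e i ∷ ρ₆ e i ∷ []))
   ranked-blocks lo h2 hk = subst (λ z → Ranked (rank-ab lo) (rank-ab z) (concatFrom lo (k ∸ lo) (λ i →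
       ρ₂ e i ∷ ρ₆ e i ∷ []))) (m+[n∸m]≡n hk)
      (Ranked-concatFrom rank-ab lo (k ∸ lo) _ (subst (λ z →
          rank-ab z ≤ rank-ab k) (sym (m+[n∸m]≡n hk)) ≤-refl) rank-ab-step
         (λ i ir → ranked-ρ₂-ρ₆ i (inRange⇒< hk ir)))

  concatFrom-ba : ∀ lo m → concatFrom lo (suc m) (λ _ → b ∷ a ∷ []) ≡ b ∷ (((a ∷ b ∷ []) ^ m) ++ a ∷ [])
  concatFrom-ba lo zero = refl
  concatFrom-ba lo (suc m) = cong (λ z → b ∷ a ∷ z) (concatFrom-ba (suc lo) m)

  concatFrom-aa : ∀ lo m → concatFrom lo m (λ _ → a ∷ a ∷ []) ≡ run (m + m) a
  concatFrom-aa lo zero = refl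
  concatFrom-aa lo (suc m) = cong (λ z → a ∷ z) (trans (cong (a ∷_) (concatFrom-aa (suc lo) m)) (cong (λ
      z → run z a) (sym (+-suc m m))))

  module Class-a³b where
   inBlock : ℕ → List Word
   inBlock i = filter (prefix? (key a 3)) (blockConjugates i)

   filter-block-above : ∀ i → 4 ≤ i → i < k → inBlock i ≡ ρ₂ 3 i ∷ ρ₆ 3 i ∷ []
   filter-block-above i h4 lt = trans (filter-block-a 2 i (≤-trans (lit 2 4) h4) lt)
       (cong (ρ₂ 3 i ∷_) (pick-hit a (i ∸ 1) (Y₆ i) (X₆ i) 3 (pred≤ h4)))
     where
     pred≤ : ∀ {i} → 4 ≤ i → 3 ≤ i ∸ 1
     pred≤ (s≤s h) = h

   ordered : List Word
   ordered = φ₂ 3 ∷ ρ₂ 3 2 ∷ ρ₂ 3 3 ∷ concatFrom 4 (k ∸ 4) (λ i → ρ₂ 3 i ∷ ρ₆ 3 i ∷ [])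

   filter-conjugates : filter (prefix? (key a 3)) (conjugates (V k))
       ≡ (ρ₂ 3 2 ∷ ρ₂ 3 3 ∷ concatFrom 4 (k ∸ 4) (λ i → ρ₂ 3 i ∷ ρ₆ 3 i ∷ [])) ++ φ₂ 3 ∷ []
   filter-conjugates = trans (filter-conjugates-V (key a 3)) (cong₂ _++_
          (cong₂ (λ u v → u ++ v) (filter-block-a 2 2 ≤-refl (lit 3 k))
              (cong₂ _++_ (filter-block-a 2 3 (lit 2 3) (lit 4 k))
             (concatFrom-cong 4 (k ∸ 4) (λ i ir → filter-block-above i (proj₁ ir) (proj₂ ir)))))
          (filter-final-a 2))

   ordered-↭ : ordered ↭ filter (prefix? (key a 3)) (conjugates (V k))
   ordered-↭ = ↭-trans (++-comm (φ₂ 3 ∷ []) (ρ₂ 3 2 ∷ ρ₂ 3 3 ∷ concatFrom 4 (k ∸ 4) (λ i →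
       ρ₂ 3 i ∷ ρ₆ 3 i ∷ []))) (↭-reflexive (sym filter-conjugates))

   open RankedAfter-aᵉ 3

   ordered-sorted : Sorted ordered
   ordered-sorted = AllPairs≺⇒Sorted (Ranked⇒AllPairs (Ranked-++ {L1 = φ₂ 3 ∷ []} (lit 4 5) (lit 5
       (rank-ab k)) ≤-refl (Ranked-single 4 (φ₂ 3) ≤-refl ≤-refl (φ₂-prefix 3))
                        (Ranked-++ {L1 = ρ₂ 3 2 ∷ []} (lit 5 7) (lit 7 (rank-ab k)) ≤-refl
                            (Ranked-single 5 (ρ₂ 3 2) ≤-refl (lit 6 7) (ρ₂-prefix 3 2))
                        (Ranked-++ {L1 = ρ₂ 3 3 ∷ []} (lit 7 9) (lit 9 (rank-ab k)) ≤-refl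
                            (Ranked-single 7 (ρ₂ 3 3) ≤-refl (lit 8 9) (ρ₂-prefix 3 3))
                        (ranked-blocks 4 (lit 2 4) (lit 4 k))))))

   lastL-ρ₆ : ∀ i → 5 ≤ i → lastL (ρ₆ 3 i) ≡ a
   lastL-ρ₆ (suc zero) (s≤s ())
   lastL-ρ₆ (suc (suc zero)) (s≤s (s≤s ()))
   lastL-ρ₆ (suc (suc (suc zero))) (s≤s (s≤s (s≤s ())))
   lastL-ρ₆ (suc (suc (suc (suc zero)))) (s≤s (s≤s (s≤s (s≤s ()))))
   lastL-ρ₆ (suc (suc (suc (suc (suc i))))) _ = runConj-lastL-pos a 3 (Y₆ (5 + i)) (X₆ (5 + i)) (suc i) (s≤s z≤n)

   lastL-block : ∀ i → InRange 5 (suc n) i → map lastL (ρ₂ 3 i ∷ ρ₆ 3 i ∷ []) ≡ b ∷ a ∷ []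
   lastL-block i (5≤i , _) = cong₂ (λ u v → u ∷ v ∷ [])
     (runConj-lastL-0 a b 3 (Y₂ i) (X₂ i) (EndsWith₂ i (≤-trans (s≤s z≤n) 5≤i))) (lastL-ρ₆ i 5≤i)

   lastL-ordered : map lastL ordered ≡ b ∷ b ∷ b ∷ b ∷ b ∷ b ∷ (((a ∷ b ∷ []) ^ n) ++ a ∷ [])
   lastL-ordered = cong₂ _∷_ (runConj-lastL-0 a b 3 Yꜰ₂ Xꜰ₂ EndsWithꜰ₂)
     (cong₂ _∷_ (runConj-lastL-0 a b 3 (Y₂ 2) (X₂ 2) (EndsWith₂ 2 (s≤s z≤n)))
     (cong₂ _∷_ (runConj-lastL-0 a b 3 (Y₂ 3) (X₂ 3) (EndsWith₂ 3 (s≤s z≤n)))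
     (trans (map-concatFrom lastL 4 (k ∸ 4) (λ i → ρ₂ 3 i ∷ ρ₆ 3 i ∷ []))
     (cong₂ _∷_ (runConj-lastL-0 a b 3 (Y₂ 4) (X₂ 4) (EndsWith₂ 4 (s≤s z≤n)))
     (cong₂ _∷_ (runConj-lastL-0 a b 3 (Y₆ 4) (X₆ 4) (EndsWith₆ 4))
     (trans (concatFrom-cong 5 (suc n) lastL-block) (concatFrom-ba 5 n)))))))

   β-value : β (key a 3) (W k) ≡ b ∷ b ∷ b ∷ b ∷ b ∷ b ∷ (((a ∷ b ∷ []) ^ n) ++ a ∷ [])
   β-value = trans (β-by-sorting (key a 3) ordered ordered-sorted ordered-↭) lastL-ordered

  module Class-a²b where
   inBlock : ℕ → List Word
   inBlock i = filter (prefix? (key a 2)) (blockConjugates i)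

   filter-block-above : ∀ i → 3 ≤ i → i < k → inBlock i ≡ ρ₂ 2 i ∷ ρ₆ 2 i ∷ []
   filter-block-above i h3 lt = trans (filter-block-a 1 i (≤-trans (lit 2 3) h3) lt)
       (cong (ρ₂ 2 i ∷_) (pick-hit a (i ∸ 1) (Y₆ i) (X₆ i) 2 (pred≤ h3)))
     where
     pred≤ : ∀ {i} → 3 ≤ i → 2 ≤ i ∸ 1
     pred≤ (s≤s h) = h

   ordered : List Word
   ordered = φ₂ 2 ∷ ρ₂ 2 2 ∷ concatFrom 3 (k ∸ 3) (λ i → ρ₂ 2 i ∷ ρ₆ 2 i ∷ [])

   filter-conjugates : filter (prefix? (key a 2)) (conjugates (V k))
       ≡ (ρ₂ 2 2 ∷ concatFrom 3 (k ∸ 3) (λ i → ρ₂ 2 i ∷ ρ₆ 2 i ∷ [])) ++ φ₂ 2 ∷ []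
   filter-conjugates = trans (filter-conjugates-V (key a 2)) (cong₂ _++_
          (cong₂ _++_ (filter-block-a 1 2 ≤-refl (lit 3 k)) (concatFrom-cong 3 (k ∸ 3) (λ i ir →
              filter-block-above i (proj₁ ir) (proj₂ ir))))
          (filter-final-a 1))

   ordered-↭ : ordered ↭ filter (prefix? (key a 2)) (conjugates (V k))
   ordered-↭ = ↭-trans (++-comm (φ₂ 2 ∷ []) (ρ₂ 2 2 ∷ concatFrom 3 (k ∸ 3) (λ i →
       ρ₂ 2 i ∷ ρ₆ 2 i ∷ []))) (↭-reflexive (sym filter-conjugates))

   open RankedAfter-aᵉ 2

   ordered-sorted : Sorted ordered
   ordered-sorted = AllPairs≺⇒Sorted (Ranked⇒AllPairs (Ranked-++ {L1 = φ₂ 2 ∷ []} (lit 4 5) (lit 5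
       (rank-ab k)) ≤-refl (Ranked-single 4 (φ₂ 2) ≤-refl ≤-refl (φ₂-prefix 2))
                        (Ranked-++ {L1 = ρ₂ 2 2 ∷ []} (lit 5 7) (lit 7 (rank-ab k)) ≤-refl
                            (Ranked-single 5 (ρ₂ 2 2) ≤-refl (lit 6 7) (ρ₂-prefix 2 2))
                        (ranked-blocks 3 (lit 2 3) (lit 3 k)))))

   lastL-ρ₆ : ∀ i → 4 ≤ i → lastL (ρ₆ 2 i) ≡ a
   lastL-ρ₆ (suc zero) (s≤s ())
   lastL-ρ₆ (suc (suc zero)) (s≤s (s≤s ()))
   lastL-ρ₆ (suc (suc (suc zero))) (s≤s (s≤s (s≤s ())))
   lastL-ρ₆ (suc (suc (suc (suc i)))) _ = runConj-lastL-pos a 2 (Y₆ (4 + i)) (X₆ (4 + i)) (suc i) (s≤s z≤n)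

   lastL-ordered : map lastL ordered ≡ a ∷ a ∷ a ∷ b ∷ run ((2 + n) + (2 + n)) a
   lastL-ordered = cong₂ _∷_ (runConj-lastL-pos a 2 Yꜰ₂ Xꜰ₂ 1 (s≤s z≤n))
           (cong₂ _∷_ (runConj-lastL-pos a 2 (Y₂ 2) (X₂ 2) 1 (s≤s z≤n))
           (trans (map-concatFrom lastL 3 (k ∸ 3) (λ i → ρ₂ 2 i ∷ ρ₆ 2 i ∷ []))
           (trans (cong₂ (λ u v → u ∷ v ∷ concatFrom 4 (2 + n) (λ i → map lastL (ρ₂ 2 i ∷ ρ₆ 2 i ∷ [])))
                (runConj-lastL-pos a 2 (Y₂ 3) (X₂ 3) 1 (s≤s z≤n))
                (runConj-lastL-0 a b 2 (Y₆ 3) (X₆ 3) (EndsWith₆ 3)))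
           (cong (λ z → a ∷ b ∷ z) (trans (concatFrom-cong 4 (2 + n) (λ i ir → cong₂ (λ u v → u ∷ v ∷ [])
                         (runConj-lastL-pos a 2 (Y₂ i) (X₂ i) 1 (s≤s z≤n)) (lastL-ρ₆ i (proj₁ ir))))
                       (concatFrom-aa 4 (2 + n)))))))

   β-value : β (key a 2) (W k) ≡ a ∷ a ∷ a ∷ b ∷ run ((2 + n) + (2 + n)) a
   β-value = trans (β-by-sorting (key a 2) ordered ordered-sorted ordered-↭) lastL-ordered

  module Class-ab where
   inBlock : ℕ → List Word
   inBlock i = filter (prefix? (key a 1)) (blockConjugates i)

   filter-block : ∀ i → 2 ≤ i → i < k → inBlock i ≡ ρ₂ 1 i ∷ ρ₄ i ∷ ρ₆ 1 i ∷ []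
   filter-block i h2 lt = trans (filter-block-a 0 i h2 lt) (cong (λ z →
       ρ₂ 1 i ∷ ρ₄ i ∷ z) (pick-hit a (i ∸ 1) (Y₆ i) (X₆ i) 1 (pred≤ h2)))
     where
     pred≤ : ∀ {i} → 2 ≤ i → 1 ≤ i ∸ 1
     pred≤ (s≤s h) = h

   [ρ₄] [ρ₂ρ₆] : ℕ → List Word
   [ρ₄] i = ρ₄ i ∷ []
   [ρ₂ρ₆] i = ρ₂ 1 i ∷ ρ₆ 1 i ∷ []

   ordered : List Word
   ordered = concatFromRev 2 (k ∸ 2) [ρ₄] ++ φ₂ 1 ∷ concatFrom 2 (k ∸ 2) [ρ₂ρ₆]

   filter-conjugates : filter (prefix? (key a 1)) (conjugates (V k)) ≡ concatFrom 2 (k ∸ 2) (λ i →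
       ρ₂ 1 i ∷ ρ₄ i ∷ ρ₆ 1 i ∷ []) ++ φ₂ 1 ∷ []
   filter-conjugates = trans (filter-conjugates-V (key a 1))
       (cong₂ _++_ (concatFrom-cong 2 (k ∸ 2) (λ i ir → filter-block i (proj₁ ir) (proj₂ ir))) (filter-final-a 0))

   ordered-↭ : ordered ↭ filter (prefix? (key a 1)) (conjugates (V k))
   ordered-↭ = ↭-trans (++⁺ʳ (φ₂ 1 ∷ concatFrom 2 (k ∸ 2) [ρ₂ρ₆]) (concatFromRev-↭ 2 (k ∸ 2) [ρ₄]))
          (↭-trans (++⁺ˡ (concatFrom 2 (k ∸ 2) [ρ₄]) (++-comm (φ₂ 1 ∷ []) (concatFrom 2 (k ∸ 2) [ρ₂ρ₆])))
          (↭-trans (↭-reflexive (sym (++-assoc (concatFrom 2 (k ∸ 2) [ρ₄]) (concatFrom 2 (k ∸ 2) [ρ₂ρ₆]) (φ₂ 1 ∷ []))))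
          (↭-trans (++⁺ʳ (φ₂ 1 ∷ []) (↭-sym (concatFrom-unzip 2 (k ∸ 2) [ρ₄] [ρ₂ρ₆])))
          (↭-trans (++⁺ʳ (φ₂ 1 ∷ []) (concatFrom-↭ 2 (k ∸ 2) {f = λ i →
              ρ₄ i ∷ ρ₂ 1 i ∷ ρ₆ 1 i ∷ []} {g = λ i → ρ₂ 1 i ∷ ρ₄ i ∷ ρ₆ 1 i ∷ []} (λ i →
              ↭-swap (ρ₄ i) (ρ₂ 1 i) ↭-refl)))
          (↭-reflexive (sym filter-conjugates))))))

   ρ₄-prefix-a : ∀ j → HasPrefix (a ∷ b ∷ (run (j ∸ 1) a ++ [])) (ρ₄ j)
   ρ₄-prefix-a j = HasPrefix-∷ a (HasPrefix-∷ b (HasPrefix-extend _ (HasPrefix-++ (run (j ∸ 1) a) (HasPrefix-[] _))))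

   ρ₄-prefix-b : ∀ i → i < k → HasPrefix (a ∷ b ∷ (run (i ∸ 1) a ++ b ∷ [])) (ρ₄ i)
   ρ₄-prefix-b i lt = HasPrefix-∷ a (HasPrefix-∷ b (HasPrefix-extend _ (HasPrefix-++ (run (i ∸ 1) a)
       (HasPrefix-truncate (b ∷ []) (run i b ++ run 3 a) (Post-prefix i lt)))))

   ρ₄-prefix-aba : ∀ i → 2 ≤ i → HasPrefix (a ∷ b ∷ a ∷ []) (ρ₄ i)
   ρ₄-prefix-aba (suc zero) (s≤s ())
   ρ₄-prefix-aba (suc (suc i)) _ = HasPrefix-∷ a (HasPrefix-∷ b (HasPrefix-∷ a (HasPrefix-[] _)))

   allPairs-ρ₄ : AllPairs _≺_ (concatFromRev 2 (k ∸ 2) [ρ₄])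
   allPairs-ρ₄ = concatFromRev-AllPairs 2 (k ∸ 2) _ (λ i _ → AllPairs-single _)
           (λ i j ri rj lt → (HasPrefix-≺ (≺-there (≺-there (aᵐ≺aⁿb (j ∸ 1) (i ∸ 1) (pred-mono-<
               (≤-trans (s≤s z≤n) (proj₁ ri)) lt))))
                                (ρ₄-prefix-a j) (ρ₄-prefix-b i (inRange⇒<k ≤-refl ri)) ∷ []) ∷ [])

   open RankedAfter-aᵉ 1

   ranked-φ₂-blocks : Ranked 4 (rank-ab k) (φ₂ 1 ∷ concatFrom 2 (k ∸ 2) [ρ₂ρ₆])
   ranked-φ₂-blocks = Ranked-++ {L1 = φ₂ 1 ∷ []} (lit 4 5) (lit 5 (rank-ab k)) ≤-refl
       (Ranked-single 4 (φ₂ 1) ≤-refl ≤-refl (φ₂-prefix 1)) (ranked-blocks 2 ≤-refl (lit 2 k))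

   κ⇒abb : ∀ {u} q → 4 ≤ q → HasPrefix (κ q) u → HasPrefix (a ∷ b ∷ b ∷ []) u
   κ⇒abb (suc zero) (s≤s ()) hp
   κ⇒abb (suc (suc zero)) (s≤s (s≤s ())) hp
   κ⇒abb (suc (suc (suc zero))) (s≤s (s≤s (s≤s ()))) hp
   κ⇒abb (suc (suc (suc (suc q)))) _ hp = HasPrefix-shorten [] (a ∷ b ∷ b ∷ []) (trailKey q) hp

   ordered-sorted : Sorted ordered
   ordered-sorted = AllPairs≺⇒Sorted (AllPairs-++-keyed {K1 = a ∷ b ∷ a ∷ []} {K2 = a ∷ b ∷ b ∷ []}
       allPairs-ρ₄ (Ranked⇒AllPairs ranked-φ₂-blocks)
      (concatFromRev-All 2 (k ∸ 2) [ρ₄] (λ i ir → ρ₄-prefix-aba i (proj₁ ir) ∷ []))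
      (All.map (λ { (q , lq , _ , hp) → κ⇒abb q lq hp }) (proj₂ ranked-φ₂-blocks))
      (≺-there (≺-there ≺-here)))

   lastL-ρ₆ : ∀ i → 3 ≤ i → lastL (ρ₆ 1 i) ≡ a
   lastL-ρ₆ (suc zero) (s≤s ())
   lastL-ρ₆ (suc (suc zero)) (s≤s (s≤s ()))
   lastL-ρ₆ (suc (suc (suc i))) _ = runConj-lastL-pos a 1 (Y₆ (3 + i)) (X₆ (3 + i)) (suc i) (s≤s z≤n)

   lastL-ordered : map lastL ordered ≡ run (4 + n) b ++ a ∷ a ∷ b ∷ run ((3 + n) + (3 + n)) a
   lastL-ordered = trans (map-++ lastL (concatFromRev 2 (k ∸ 2) [ρ₄]) _) (cong₂ _++_
      (trans (map-concatFromRev lastL 2 (k ∸ 2) [ρ₄]) (trans (concatFromRev-cong 2 (k ∸ 2) (λ i ir → cong (_∷ [])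
         (runConj-lastL-0 a b 1 (Y₄ i) (X₄ i) (EndsWith₄ i (≤-trans (s≤s z≤n) (proj₁ ir))))))
             (concatFromRev-const 2 (k ∸ 2) b)))
      (cong₂ _∷_ (runConj-lastL-pos a 1 Yꜰ₂ Xꜰ₂ 2 (s≤s z≤n))
        (trans (map-concatFrom lastL 2 (k ∸ 2) [ρ₂ρ₆])
        (trans (cong₂ (λ u v → u ∷ v ∷ concatFrom 3 (3 + n) (λ i → map lastL ([ρ₂ρ₆] i)))
                (runConj-lastL-pos a 1 (Y₂ 2) (X₂ 2) 2 (s≤s z≤n))
                (runConj-lastL-0 a b 1 (Y₆ 2) (X₆ 2) (EndsWith₆ 2)))
           (cong (λ z → a ∷ b ∷ z) (trans (concatFrom-cong 3 (3 + n) (λ i ir → cong₂ (λ u v → u ∷ v ∷ [])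
                         (runConj-lastL-pos a 1 (Y₂ i) (X₂ i) 2 (s≤s z≤n)) (lastL-ρ₆ i (proj₁ ir))))
                       (concatFrom-aa 3 (3 + n))))))))

   β-value : β (key a 1) (W k) ≡ run (4 + n) b ++ a ∷ a ∷ b ∷ run ((3 + n) + (3 + n)) a
   β-value = trans (β-by-sorting (key a 1) ordered ordered-sorted ordered-↭) lastL-ordered

  module Class-aᵉb (e′ : ℕ) (4≤e : 4 ≤ suc e′) (e≤k∸2 : suc e′ ≤ k ∸ 2) where
   e : ℕ
   e = suc e′

   e<k∸1 : suc e < k
   e<k∸1 = ≤-trans (s≤s (s≤s e≤k∸2)) (≤-reflexive (m+[n∸m]≡n {2} {k} (lit 2 k)))

   inBlock : ℕ → List Word
   inBlock i = filter (prefix? (key a e)) (blockConjugates i)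

   3<e : 3 < e
   3<e = 4≤e

   pred<e : ∀ i → i < suc e → i ∸ 1 < e
   pred<e zero _ = s≤s z≤n
   pred<e (suc i) (s≤s h) = h

   e≤pred : ∀ i → suc e ≤ i → e ≤ i ∸ 1
   e≤pred (suc i) (s≤s h) = h

   filter-block-below : ∀ i → 2 ≤ i → i < suc e → inBlock i ≡ []
   filter-block-below i h2 lt with filter-block-a e′ i h2 (≤-trans lt (<⇒≤ e<k∸1))
   ... | q rewrite pick-miss a 3 (Y₂ i) (X₂ i) e 3<e | pick-miss a 1 (Y₄ i) (X₄ i) e
       (≤-trans (lit 2 4) 4≤e) | pick-miss a (i ∸ 1) (Y₆ i) (X₆ i) e (pred<e i lt) = q

   filter-block-above : ∀ i → suc e ≤ i → i < k → inBlock i ≡ ρ₆ e i ∷ []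
   filter-block-above i le lt with filter-block-a e′ i (≤-trans (lit 2 5) (≤-trans (s≤s 4≤e) le)) lt
   ... | q rewrite pick-miss a 3 (Y₂ i) (X₂ i) e 3<e | pick-miss a 1 (Y₄ i) (X₄ i) e
       (≤-trans (lit 2 4) 4≤e) | pick-hit a (i ∸ 1) (Y₆ i) (X₆ i) e (e≤pred i le) = q

   filter-final : filter (prefix? (key a e)) finalConjugates ≡ []
   filter-final with filter-final-a e′
   ... | q rewrite pick-miss a 3 Yꜰ₂ Xꜰ₂ e 3<e = q

   ordered : List Word
   ordered = concatFrom (suc e) (k ∸ suc e) (λ i → ρ₆ e i ∷ [])

   filter-conjugates : filter (prefix? (key a e)) (conjugates (V k)) ≡ ordered
   filter-conjugates = trans (filter-conjugates-V (key a e)) (trans (cong₂ _++_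
          (trans (concatFrom-split 2 (suc e) k inBlock (≤-trans (lit 2 5) (s≤s 4≤e)) (<⇒≤ e<k∸1))
            (cong₂ _++_ (concatFrom-[] 2 (suc e ∸ 2) inBlock (λ i ir →
                filter-block-below i (proj₁ ir) (inRange⇒< (≤-trans (lit 2 5) (s≤s 4≤e)) ir)))
                        (concatFrom-cong (suc e) (k ∸ suc e) (λ i ir →
                            filter-block-above i (proj₁ ir) (inRange⇒< (<⇒≤ e<k∸1) ir)))))
          filter-final) (++-identityʳ ordered))

   ρ₆-prefix-bᵢ₊₁a³ : ∀ i → i < k → HasPrefix (run e a ++ (run (suc i) b ++ run 3 a)) (ρ₆ e i)
   ρ₆-prefix-bᵢ₊₁a³ i lt = HasPrefix-++ (run e a) (HasPrefix-extend _ (Post-prefix i lt))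

   ordered-sorted : Sorted ordered
   ordered-sorted = AllPairs≺⇒Sorted (concatFrom-AllPairs (suc e) (k ∸ suc e) _ (λ i _ → AllPairs-single _)
      (λ i j ri rj lt → (HasPrefix-≺ (++-≺ (run e a) (bᵐa≺bⁿ (suc i) (suc j) (s≤s lt)))
          (ρ₆-prefix-bᵢ₊₁a³ i (inRange⇒< (<⇒≤ e<k∸1) ri))
          (ρ₆-prefix-bᵢ₊₁a³ j (inRange⇒< (<⇒≤ e<k∸1) rj)) ∷ []) ∷ []))

   gap : ℕ
   gap = proj₁ (pos-∸ e<k∸1)
   k∸1+e≡1+gap : k ∸ suc e ≡ suc gap
   k∸1+e≡1+gap = proj₂ (pos-∸ e<k∸1)

   lastL-ρ₆-first : lastL (ρ₆ e (suc e)) ≡ b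
   lastL-ρ₆-first rewrite n∸n≡0 e = runConj-lastL-0 a b e (Y₆ (suc e)) (X₆ (suc e)) (EndsWith₆ (suc e))

   gap-pos : ∀ i → suc (suc e) ≤ i → 1 ≤ i ∸ 1 ∸ e
   gap-pos (suc i) (s≤s h) = m<n⇒0<n∸m h

   lastL-ordered : map lastL ordered ≡ b ∷ run gap a
   lastL-ordered = trans (map-concatFrom lastL (suc e) (k ∸ suc e) (λ i → ρ₆ e i ∷ []))
     (trans (cong (λ z → concatFrom (suc e) z (λ i → lastL (ρ₆ e i) ∷ [])) k∸1+e≡1+gap)
     (cong₂ _∷_ lastL-ρ₆-first (trans (concatFrom-cong (suc (suc e)) gap (λ i ir →
         cong (_∷ []) (runConj-lastL-pos a e (Y₆ i) (X₆ i) (i ∸ 1 ∸ e) (gap-pos i (proj₁ ir)))))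
                       (concatFrom-const (suc (suc e)) gap a))))

   gap≡k∸e∸2 : gap ≡ k ∸ e ∸ 2
   gap≡k∸e∸2 = sym (trans (∸-+-assoc k e 2) (trans (cong (k ∸_) (+-suc e 1)) (trans (sym (∸-+-assoc k
       (suc e) 1)) (cong (_∸ 1) k∸1+e≡1+gap))))

   β-value : β (key a e) (W k) ≡ b ∷ run (k ∸ e ∸ 2) a
   β-value = trans (β-by-sorting (key a e) ordered ordered-sorted (↭-reflexive (sym filter-conjugates)))
       (trans lastL-ordered (cong (λ z → b ∷ run z a) gap≡k∸e∸2))


  #keysA #keysB : ℕ
  #keysA = suc (k ∸ 1) ∸ 2
  #keysB = suc k ∸ 1

  keyA keyB : ℕ → Word
  keyA j = aᵉb (k ∸ (2 + j))
  keyB j = bᵐa (1 + j)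

  keysA keysB keys : List Word
  keysA = map keyA (upTo #keysA)
  keysB = map keyB (upTo #keysB)
  keys = keysA ++ keysB

  keysA-ordered : AllPairs _≺_ keysA
  keysA-ordered = subst (AllPairs _≺_) (sym (map-upTo keyA #keysA)) (APP.applyUpTo⁺₁ keyA #keysA (λ {i} {j} i<j j<N →
          subst₂ _≺_ (sym (aᵉb≡key (k ∸ (2 + i)))) (sym (aᵉb≡key (k ∸ (2 + j))))
            (aᵐ≺aⁿb (k ∸ (2 + i)) (k ∸ (2 + j)) {p = b ∷ []} {q = []}
                (∸-monoʳ-< (s≤s (s≤s i<j)) (s≤s (s≤s (<⇒≤ j<N)))))))

  keysB-ordered : AllPairs _≺_ keysB
  keysB-ordered = subst (AllPairs _≺_) (sym (map-upTo keyB #keysB)) (APP.applyUpTo⁺₁ keyB #keysB (λ {i} {j} i<j j<N →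
          subst₂ _≺_ (sym (bᵐa≡key (1 + i))) (sym (bᵐa≡key (1 + j)))
              (bᵐa≺bⁿ (1 + i) (1 + j) {p = []} {q = a ∷ []} (s≤s i<j))))

  keysA≺keysB : All (λ x → All (x ≺_) keysB) keysA
  keysA≺keysB = subst (All _) (sym (map-upTo keyA #keysA)) (AllP.applyUpTo⁺₁ keyA #keysA (λ {i} i<N →
      subst (All _) (sym (map-upTo keyB #keysB)) (AllP.applyUpTo⁺₁ keyB #keysB (λ {j} _ → keyA≺keyB i i<N j))))
    where
    keyA≺keyB : ∀ i → i < #keysA → ∀ j → keyA i ≺ keyB j
    keyA≺keyB i lt j with pos-∸ {2 + i} {k} (s≤s (s≤s lt))
    ... | t , eq = subst (λ z → aᵉb z ≺ keyB j) (sym eq) ≺-here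

  keys-ordered : AllPairs _≺_ keys
  keys-ordered = APP.++⁺ keysA-ordered keysB-ordered keysA≺keysB

  key-a∈keys : ∀ e → 1 ≤ e → e ≤ 4 + n → Any (λ x → x ≡ key a e) keys
  key-a∈keys e h1 h2 = AnyP.++⁺ˡ (subst (Any _) (sym (map-upTo keyA #keysA))
    (AnyP.applyUpTo⁺ keyA {i = (4 + n) ∸ e} (trans (cong aᵉb (m∸[m∸n]≡n h2)) (aᵉb≡key e)) (∸-monoʳ-< h1 h2)))

  key-b∈keys : ∀ m → 1 ≤ m → m ≤ k → Any (λ x → x ≡ key b m) keys
  key-b∈keys (suc m) _ h2 = AnyP.++⁺ʳ keysA (subst (Any _) (sym (map-upTo keyB #keysB))
    (AnyP.applyUpTo⁺ keyB {i = m} (bᵐa≡key (suc m)) h2))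

  runRotations-covered : ∀ c ℓ Y X → HasHead (other c) (Y ++ X) → (∀ e → 1 ≤ e → e ≤ ℓ → Any (λ x → x
      ≡ key c e) keys) → All (HasPrefixIn keys) (runRotations c ℓ Y X)
  runRotations-covered c ℓ Y X hh mem = AllP.applyUpTo⁺₁ _ ℓ (λ {p} p<ℓ →
     Any.map (λ {x} eq → subst (λ z → isPrefix z _ ≡ true) (sym eq)
         (key-prefix′ c (ℓ ∸ p) _ (HasHead-++-++ Y X (run p c) hh)))
       (mem (ℓ ∸ p) (m<n⇒0<n∸m p<ℓ) (m∸n≤m ℓ p)))

  key-a∈keys-≤ : ∀ ℓ → ℓ ≤ 4 + n → ∀ e → 1 ≤ e → e ≤ ℓ → Any (λ x → x ≡ key a e) keys
  key-a∈keys-≤ ℓ hℓ e h1 h2 = key-a∈keys e h1 (≤-trans h2 hℓ)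

  key-b∈keys-≤ : ∀ ℓ → ℓ ≤ k → ∀ e → 1 ≤ e → e ≤ ℓ → Any (λ x → x ≡ key b e) keys
  key-b∈keys-≤ ℓ hℓ e h1 h2 = key-b∈keys e h1 (≤-trans h2 hℓ)

  pred≤ : ∀ i → i < k → i ∸ 1 ≤ 4 + n
  pred≤ zero _ = z≤n
  pred≤ (suc i) (s≤s (s≤s h)) = h

  blockConjugates-covered : ∀ i → 2 ≤ i → i < k → All (HasPrefixIn keys) (blockConjugates i)
  blockConjugates-covered i h2 lt = subst (All (HasPrefixIn keys)) (sym (blockConjugates-runs i))
    (AllP.++⁺ (runRotations-covered b i (Y₁ i) (X₁ i) (head₁ i) (key-b∈keys-≤ i (<⇒≤ lt)))
    (AllP.++⁺ (runRotations-covered a 3 (Y₂ i) (X₂ i) (head₂ i (<⇒≤ h2)) (key-a∈keys-≤ 3 (lit 3 (4 + n))))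
    (AllP.++⁺ (runRotations-covered b i (Y₃ i) (X₃ i) (head₃ i) (key-b∈keys-≤ i (<⇒≤ lt)))
    (AllP.++⁺ (runRotations-covered a 1 (Y₄ i) (X₄ i) (head₄ i) (key-a∈keys-≤ 1 (lit 1 (4 + n))))
    (AllP.++⁺ (runRotations-covered b 1 (Y₅ i) (X₅ i) (head₅ i h2) (key-b∈keys-≤ 1 (lit 1 k)))
    (runRotations-covered a (i ∸ 1) (Y₆ i) (X₆ i) (head₆ i lt) (key-a∈keys-≤ (i ∸ 1) (pred≤ i lt))))))))

  finalConjugates-covered : All (HasPrefixIn keys) finalConjugates
  finalConjugates-covered = subst (All (HasPrefixIn keys)) (sym finalConjugates-runs)
    (AllP.++⁺ (runRotations-covered b k Yꜰ₁ Xꜰ₁ headꜰ₁ (key-b∈keys-≤ k ≤-refl))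
        (runRotations-covered a 3 Yꜰ₂ Xꜰ₂ headꜰ₂ (key-a∈keys-≤ 3 (lit 3 (4 + n)))))

  conjugates-V-covered : All (HasPrefixIn keys) (conjugates (V k))
  conjugates-V-covered = subst (All (HasPrefixIn keys)) (sym conjugates-V)
      (AllP.++⁺ (concatFrom-All 2 (k ∸ 2) blockConjugates (λ i ir →
      blockConjugates-covered i (proj₁ ir) (proj₂ ir))) finalConjugates-covered)

  conjugates-W-covered : All (HasPrefixIn keys) (conjugates (W k))
  conjugates-W-covered = All-resp-↭ (↭-sym (conjugates-W↭V k (s≤s z≤n))) conjugates-V-covered

  BWT-W : BWT (W k) ≡ prod 2 (k ∸ 1) (λ i → β (((a ∷ []) ^ (k ∸ i)) ++ (b ∷ [])) (W k))
                          ++ prod 1 k (λ i → β (((b ∷ []) ^ i) ++ (a ∷ [])) (W k))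
  BWT-W = trans (BWT≡concat-β (W k) keys keys-ordered conjugates-W-covered)
      (trans (cong concat (map-++ (λ x → β x (W k)) keysA keysB))
    (trans (sym (concat-++ (map (λ x → β x (W k)) keysA) (map (λ x → β x (W k)) keysB)))
    (cong₂ _++_ (concat-map-upTo≡prod (λ i → β (((a ∷ []) ^ (k ∸ i)) ++ (b ∷ [])) (W k)) 2 (k ∸ 1)
        (λ x → β x (W k)) keyA (λ j → refl))
                (concat-map-upTo≡prod (λ i → β (((b ∷ []) ^ i) ++ (a ∷ [])) (W k)) 1 k (λ x →
                    β x (W k)) keyB (λ j → refl)))))

  β-aⁱb : (i : ℕ) → 4 ≤ i → i ≤ k ∸ 2 → β (((a ∷ []) ^ i) ++ (b ∷ [])) (W k) ≡ (b ∷ []) ++ ((a ∷ []) ^ (k ∸ i ∸ 2))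
  β-aⁱb (suc e') h1 h2 = trans (cong (λ z → β z (W k)) (aᵉb≡key (suc e')))
      (trans (Class-aᵉb.β-value e' h1 h2) (cong (b ∷_) (sym ([c]^n≡run _ a))))

  β-a³b : β (a ∷ a ∷ a ∷ b ∷ []) (W k) ≡ (b ∷ []) ++ ((b ∷ []) ^ 5) ++ ((a ∷ b ∷ []) ^ (k ∸ 6)) ++ (a ∷ [])
  β-a³b = Class-a³b.β-value

  2k∸8 : 2 * k ∸ 8 ≡ (2 + n) + (2 + n)
  2k∸8 = trans (cong (_∸ 8) (eq n)) (m+n∸m≡n 8 _)
    where
    eq : ∀ n → 2 * (6 + n) ≡ 8 + ((2 + n) + (2 + n))
    eq = solve-∀

  2k∸6 : 2 * k ∸ 6 ≡ (3 + n) + (3 + n)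
  2k∸6 = trans (cong (_∸ 6) (eq n)) (m+n∸m≡n 6 _)
    where
    eq : ∀ n → 2 * (6 + n) ≡ 6 + ((3 + n) + (3 + n))
    eq = solve-∀

  β-a²b : β (a ∷ a ∷ b ∷ []) (W k) ≡ (a ∷ a ∷ a ∷ b ∷ []) ++ ((a ∷ []) ^ (2 * k ∸ 8))
  β-a²b = trans (Class-a²b.β-value) (cong (λ z → a ∷ a ∷ a ∷ b ∷ z) (trans (cong (λ z →
      run z a) (sym 2k∸8)) (sym ([c]^n≡run _ a))))

  β-ab : β (a ∷ b ∷ []) (W k) ≡ ((b ∷ []) ^ (k ∸ 2)) ++ (a ∷ a ∷ b ∷ []) ++ ((a ∷ []) ^ (2 * k ∸ 6))
  β-ab = trans (Class-ab.β-value) (cong₂ (λ u v → u ++ a ∷ a ∷ b ∷ v) (sym ([c]^n≡run (4 + n) b))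
         (trans (cong (λ z → run z a) (sym 2k∸6)) (sym ([c]^n≡run _ a))))

  β-ba : β (b ∷ a ∷ []) (W k) ≡ ((a ∷ []) ^ (k ∸ 5)) ++ (b ∷ b ∷ b ∷ b ∷ a ∷ []) ++ ((b ∷ []) ^ (k ∸ 5))
             ++ (a ∷ []) ++ ((b ∷ []) ^ (k ∸ 2)) ++ (a ∷ [])
  β-ba = trans (Class-ba.β-value) (sym e)
    where
    e : ((a ∷ []) ^ (suc n)) ++ (b ∷ b ∷ b ∷ b ∷ a ∷ []) ++ ((b ∷ []) ^ (suc n)) ++ (a ∷ []) ++
        ((b ∷ []) ^ (4 + n)) ++ (a ∷ [])
        ≡ run (suc n) a ++ (b ∷ b ∷ b ∷ b ∷ a ∷ (run (suc n) b ++ (a ∷ (run (4 + n) b ++ a ∷ []))))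
    e = cong₂ (λ u v → u ++ (b ∷ b ∷ b ∷ b ∷ a ∷ v)) ([c]^n≡run (suc n) a)
          (cong₂ (λ u v → u ++ (a ∷ (v ++ a ∷ []))) ([c]^n≡run (suc n) b) ([c]^n≡run (4 + n) b))

  β-bʲa : (j : ℕ) → 2 ≤ j → j ≤ k ∸ 1 → β (((b ∷ []) ^ j) ++ (a ∷ [])) (W k)
      ≡ (b ∷ a ∷ []) ++ ((b ∷ []) ^ (2 * k ∸ 2 * j ∸ 2)) ++ (a ∷ [])
  β-bʲa (suc m') h2 hj = trans (cong (λ z → β z (W k)) (bᵐa≡key (suc m')))
      (trans (Class-bᵐa.β-value m' h2 (s≤s hj))
        (cong (λ z → b ∷ a ∷ (z ++ a ∷ [])) (trans (cong (λ z →
            run z b) (sym (doubled-gap (suc m') _ k (sym (Class-bᵐa.m+1+gap≡k m' h2 (s≤s hj))))))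
            (sym ([c]^n≡run _ b)))))

  β-bᵏa : β (((b ∷ []) ^ k) ++ (a ∷ [])) (W k) ≡ (a ∷ [])
  β-bᵏa = trans (cong (λ z → β z (W k)) (bᵐa≡key k)) (Class-bᵏa.β-value)


  valueA : ℕ → Word
  valueA i = b ∷ run (i ∸ 2) a

  gapB : ℕ → ℕ
  gapB j = 2 * k ∸ 2 * j ∸ 2

  valueB : ℕ → Word
  valueB j = b ∷ a ∷ (run (gapB j) b ++ a ∷ [])

  head-concat-valueA : ∀ lo m w → HasHead b (concatFrom lo m valueA ++ b ∷ w)
  head-concat-valueA lo zero w = w , refl
  head-concat-valueA lo (suc m) w = _ , refl

  runsFrom-b∷ : ∀ β₂β₁ → HasHead b β₂β₁ → runsFrom a β₂β₁ ≡ suc (runsFrom b β₂β₁)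
  runsFrom-b∷ .(b ∷ w) (w , refl) = refl

  runsFrom-concat-valueA : ∀ lo m w → 3 ≤ lo → runsFrom b (concatFrom lo m valueA ++ b ∷ w) ≡ (m + m) + runsFrom b w
  runsFrom-concat-valueA lo zero w h3 = refl
  runsFrom-concat-valueA (suc zero) (suc m) w (s≤s ())
  runsFrom-concat-valueA (suc (suc zero)) (suc m) w (s≤s (s≤s ()))
  runsFrom-concat-valueA (suc (suc (suc lo))) (suc m) w h3 =
    trans (cong (runsFrom b) (++-assoc (valueA (3 + lo)) (concatFrom (4 + lo) m valueA) (b ∷ w)))
    (trans (cong suc (runsFrom-run a lo (concatFrom (4 + lo) m valueA ++ b ∷ w)))
    (trans (cong suc (runsFrom-b∷ _ (head-concat-valueA (4 + lo) m w)))
    (trans (cong (λ z → suc (suc z)) (runsFrom-concat-valueA (4 + lo) m w (s≤s (s≤s (s≤s z≤n)))))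
    (cong (_+ runsFrom b w) (cong suc (sym (+-suc m m)))))))

  runsFrom-abᵐa : ∀ m R → runsFrom b ((((a ∷ b ∷ []) ^ m) ++ a ∷ []) ++ R) ≡ suc ((m + m) + runsFrom a R)
  runsFrom-abᵐa zero R = refl
  runsFrom-abᵐa (suc m) R = cong (λ z → suc (suc z))
      (trans (runsFrom-abᵐa m R) (cong (_+ runsFrom a R) (sym (+-suc m m))))

  β₃ β₂ β₁ βba βbᵏ⁻¹a : Word
  β₃ = b ∷ b ∷ b ∷ b ∷ b ∷ b ∷ (((a ∷ b ∷ []) ^ n) ++ a ∷ [])
  β₂ = a ∷ a ∷ a ∷ b ∷ run ((2 + n) + (2 + n)) a
  β₁ = run (4 + n) b ++ a ∷ a ∷ b ∷ run ((3 + n) + (3 + n)) a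
  βba = run (suc n) a ++ (b ∷ b ∷ b ∷ b ∷ a ∷ (run (suc n) b ++ (a ∷ (run (4 + n) b ++ a ∷ []))))
  βbᵏ⁻¹a = b ∷ a ∷ (run 0 b ++ a ∷ [])

  runsFrom-β₂ : ∀ R → runsFrom a (β₂ ++ R) ≡ 2 + runsFrom a R
  runsFrom-β₂ R = cong (λ z → suc (suc z)) (runsFrom-run a (suc (n + (2 + n))) R)

  runsFrom-β₁ : ∀ R → runsFrom a (β₁ ++ R) ≡ 4 + runsFrom a R
  runsFrom-β₁ R = trans (cong (λ z → suc (runsFrom b z)) (++-assoc (run n b) (a ∷ a ∷ b ∷ run ((3 + n) + (3 + n)) a) R))
         (trans (cong suc (runsFrom-run b n ((a ∷ a ∷ b ∷ run ((3 + n) + (3 + n)) a) ++ R)))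
             (cong (λ z → suc (suc (suc (suc z)))) (runsFrom-run a (suc (n + (3 + n))) R)))

  runsFrom-βba : ∀ R → runsFrom a (βba ++ R) ≡ 6 + runsFrom a R
  runsFrom-βba R = trans (cong (runsFrom a) (++-assoc (run (suc n) a) _ R))
         (trans (runsFrom-run a (suc n) _)
         (trans (cong (λ z → suc (suc (runsFrom a z))) (++-assoc (run (suc n) b) (a ∷ (run (4 + n) b ++ a ∷ [])) R))
         (trans (cong (λ z → suc (suc (suc z))) (runsFrom-run b n (a ∷ ((run (4 + n) b ++ a ∷ []) ++ R))))
         (trans (cong (λ z → suc (suc (suc (suc (runsFrom a z))))) (++-assoc (run (4 + n) b) (a ∷ []) R))
                (cong (λ z → suc (suc (suc (suc (suc z))))) (runsFrom-run b (3 + n) (a ∷ R)))))))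

  runsFrom-valueB : ∀ p R → 1 ≤ p → runsFrom a ((b ∷ a ∷ (run p b ++ a ∷ [])) ++ R) ≡ 4 + runsFrom a R
  runsFrom-valueB (suc t) R _ = trans (cong (λ z → suc (suc (suc (runsFrom b z)))) (++-assoc (run t b)
      (a ∷ []) R)) (cong (λ z → suc (suc (suc z))) (runsFrom-run b t (a ∷ R)))

  ar4 : ∀ m c → 4 + ((m + m) + (m + m) + c) ≡ ((suc m + suc m) + (suc m + suc m)) + c
  ar4 = solve-∀

  runsFrom-concat-valueB : ∀ lo m R → (∀ j → InRange lo m j → 1 ≤ gapB j) →
      runsFrom a (concatFrom lo m valueB ++ R) ≡ ((m + m) + (m + m)) + runsFrom a R
  runsFrom-concat-valueB lo zero R pos = refl
  runsFrom-concat-valueB lo (suc m) R pos =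
    trans (cong (runsFrom a) (++-assoc (valueB lo) (concatFrom (suc lo) m valueB) R))
    (trans (runsFrom-valueB (gapB lo) (concatFrom (suc lo) m valueB ++ R) (pos lo (inRange-head lo m)))
    (trans (cong (4 +_) (runsFrom-concat-valueB (suc lo) m R (λ j r →
        pos j (inRange-tail lo m j r)))) (ar4 m (runsFrom a R))))

  classA classB : ℕ → Word
  classA i = β (((a ∷ []) ^ (k ∸ i)) ++ (b ∷ [])) (W k)
  classB j = β (((b ∷ []) ^ j) ++ (a ∷ [])) (W k)

  classA≡valueA : ∀ i → InRange 2 (1 + n) i → classA i ≡ valueA i
  classA≡valueA i (h2 , lt) = trans (β-aⁱb (k ∸ i) h4 (∸-monoʳ-≤ k h2))
      (cong (b ∷_) (trans ([c]^n≡run _ a) (cong (λ z → run (z ∸ 2) a) (m∸[m∸n]≡n {k} {i} (≤-trans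
          (≤-pred lt) (+-monoˡ-≤ n (lit 2 6)))))))
    where
    h4 : 4 ≤ k ∸ i
    h4 = ≤-trans (≤-reflexive (sym (m+n∸n≡m 4 n))) (∸-monoʳ-≤ k (≤-pred lt))

  concat-classA : concatFrom 2 (4 + n) classA ≡ b ∷ (concatFrom 3 n valueA ++ (β₃ ++ (β₂ ++ (β₁ ++ []))))
  concat-classA = trans (cong (λ z → concatFrom 2 z classA) (sym (+-comm (1 + n) 3)))
         (trans (concatFrom-+ 2 (1 + n) 3 classA)
         (cong₂ _++_ (concatFrom-cong 2 (1 + n) classA≡valueA)
           (cong₂ _++_ (trans (cong (λ z → β (((a ∷ []) ^ z) ++ (b ∷ [])) (W k)) (m+n∸n≡m 3 n)) β-a³b)
           (cong₂ _++_ (trans (cong (λ z → β (((a ∷ []) ^ z) ++ (b ∷ [])) (W k)) (m+n∸n≡m 2 n)) (Class-a²b.β-value))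
           (cong₂ _++_ (trans (cong (λ z → β (((a ∷ []) ^ z) ++ (b ∷ [])) (W k)) (m+n∸n≡m 1 n))
               (Class-ab.β-value)) refl)))))

  classB≡valueB : ∀ j → InRange 2 (3 + n) j → classB j ≡ valueB j
  classB≡valueB j (h2 , lt) = trans (β-bʲa j h2 (≤-trans (≤-pred lt) (+-monoˡ-≤ n (lit 4 5))))
      (cong (λ z → b ∷ a ∷ (z ++ a ∷ [])) ([c]^n≡run _ b))

  classB-k∸1 : classB (5 + n) ≡ βbᵏ⁻¹a
  classB-k∸1 = trans (β-bʲa (5 + n) (lit 2 (5 + n)) ≤-refl) (cong (λ z → b ∷ a ∷ (z ++ a ∷ [])) (trans ([c]^n≡run _ b)
         (cong (λ z → run z b) (doubled-gap (5 + n) 0 k (sym (+-comm (5 + n) 1))))))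

  concat-classB : concatFrom 1 (6 + n) classB ≡ βba ++ ((concatFrom 2 (3 + n) valueB ++ βbᵏ⁻¹a) ++ (a ∷ []))
  concat-classB = cong₂ _++_ (Class-ba.β-value) (trans (concatFrom-∷ʳ 2 (4 + n) classB)
           (cong₂ _++_ (trans (concatFrom-∷ʳ 2 (3 + n) classB)
               (cong₂ _++_ (concatFrom-cong 2 (3 + n) classB≡valueB) classB-k∸1)) β-bᵏa))

  BWT-W-explicit : BWT (W k) ≡ (b ∷ (concatFrom 3 n valueA ++ (β₃ ++ (β₂ ++ (β₁ ++ []))))) ++
      (βba ++ ((concatFrom 2 (3 + n) valueB ++ βbᵏ⁻¹a) ++ (a ∷ [])))
  BWT-W-explicit = trans BWT-W (cong₂ _++_ (trans (prod≡concatFrom 2 (k ∸ 1) classA) concat-classA)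
      (trans (prod≡concatFrom 1 k classB) concat-classB))

  gapB-pos : ∀ j → InRange 2 (3 + n) j → 1 ≤ gapB j
  gapB-pos j (h2 , lt) = subst (1 ≤_) (sym (doubled-gap j (suc t) k eqk)) (s≤s z≤n)
    where
    jle : j ≤ 4 + n
    jle = ≤-pred lt
    t : ℕ
    t = (4 + n) ∸ j
    eqk : k ≡ j + suc (suc t)
    eqk = sym (trans (+-suc j (suc t)) (cong suc (trans (+-suc j t) (cong suc (m+[n∸m]≡n jle)))))

  bPart : Word
  bPart = βba ++ ((concatFrom 2 (3 + n) valueB ++ βbᵏ⁻¹a) ++ (a ∷ []))

  runsFrom-bPart : runsFrom a bPart ≡ 6 + ((((3 + n) + (3 + n)) + ((3 + n) + (3 + n))) + 2)
  runsFrom-bPart = trans (runsFrom-βba _) (cong (6 +_) (trans (cong (runsFrom a) (++-assoc (concatFrom 2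
      (3 + n) valueB) βbᵏ⁻¹a (a ∷ []))) (runsFrom-concat-valueB 2 (3 + n) (βbᵏ⁻¹a ++ a ∷ []) gapB-pos)))

  β₂β₁ : Word
  β₂β₁ = β₂ ++ (β₁ ++ [])

  runsFrom-β₂β₁ : runsFrom a (β₂β₁ ++ bPart) ≡ 2 + (4 + runsFrom a bPart)
  runsFrom-β₂β₁ = trans (cong (runsFrom a) (++-assoc β₂ (β₁ ++ []) bPart))
      (trans (runsFrom-β₂ _) (cong (2 +_) (trans (cong (λ z →
      runsFrom a (z ++ bPart)) (++-identityʳ β₁)) (runsFrom-β₁ bPart))))

  rest : Word
  rest = (b ∷ b ∷ b ∷ b ∷ b ∷ (((a ∷ b ∷ []) ^ n) ++ a ∷ []) ++ β₂β₁) ++ bPart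

  runsFrom-rest : runsFrom b rest ≡ suc ((n + n) + runsFrom a (β₂β₁ ++ bPart))
  runsFrom-rest = trans (cong (runsFrom b) (++-assoc (((a ∷ b ∷ []) ^ n) ++ a ∷ []) β₂β₁ bPart))
      (runsFrom-abᵐa n (β₂β₁ ++ bPart))

  r-W : r (W k) ≡ 8 * k ∸ 20
  r-W = begin
    runs (BWT (W k))
      ≡⟨ cong runs BWT-W-explicit ⟩
    suc (runsFrom b ((concatFrom 3 n valueA ++ β₃ ++ β₂β₁) ++ bPart))
      ≡⟨ cong (suc ∘ runsFrom b) (++-assoc (concatFrom 3 n valueA) (β₃ ++ β₂β₁) bPart) ⟩
    suc (runsFrom b (concatFrom 3 n valueA ++ b ∷ rest))
      ≡⟨ cong suc (runsFrom-concat-valueA 3 n rest ≤-refl) ⟩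
    suc ((n + n) + runsFrom b rest)
      ≡⟨ cong (λ z → suc ((n + n) + z)) runsFrom-rest ⟩
    suc ((n + n) + suc ((n + n) + runsFrom a (β₂β₁ ++ bPart)))
      ≡⟨ cong (λ z → suc ((n + n) + suc ((n + n) + z))) runsFrom-β₂β₁ ⟩
    suc ((n + n) + suc ((n + n) + (2 + (4 + runsFrom a bPart))))
      ≡⟨ cong (λ z → suc ((n + n) + suc ((n + n) + (2 + (4 + z))))) runsFrom-bPart ⟩
    suc ((n + n) + suc ((n + n) + (2 + (4 + (6 + ((((3 + n) + (3 + n)) + ((3 + n) + (3 + n))) + 2))))))
      ≡⟨ total n ⟩
    20 + (28 + 8 * n) ∸ 20
      ≡⟨ cong (_∸ 20) (8*k n) ⟩
    8 * k ∸ 20 ∎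
    where
    open ≡-Reasoning
    total : ∀ n → suc ((n + n) + suc ((n + n) + (2 + (4 + (6 + ((((3 + n) + (3 + n)) + ((3 + n) + (3 + n))) + 2))))))
                  ≡ 20 + (28 + 8 * n) ∸ 20
    total n = trans (count n) (sym (m+n∸m≡n 20 (28 + 8 * n)))
      where
      count : ∀ n → suc ((n + n) + suc ((n + n) + (2 + (4 + (6 + ((((3 + n) + (3 + n)) + ((3 + n) + (3 + n))) + 2))))))
                    ≡ 28 + 8 * n
      count = solve-∀
    8*k : ∀ n → 20 + (28 + 8 * n) ≡ 8 * (6 + n)
    8*k = solve-∀

lemma18 : (k : ℕ) → 5 < k →
    ((i : ℕ) → 4 ≤ i → i ≤ k ∸ 2 →
       β (((a ∷ []) ^ i) ++ (b ∷ [])) (W k) ≡ (b ∷ []) ++ ((a ∷ []) ^ (k ∸ i ∸ 2)))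
  × (β (a ∷ a ∷ a ∷ b ∷ []) (W k)
       ≡ (b ∷ []) ++ ((b ∷ []) ^ 5) ++ ((a ∷ b ∷ []) ^ (k ∸ 6)) ++ (a ∷ []))
  × (β (a ∷ a ∷ b ∷ []) (W k)
       ≡ (a ∷ a ∷ a ∷ b ∷ []) ++ ((a ∷ []) ^ (2 * k ∸ 8)))
  × (β (a ∷ b ∷ []) (W k)
       ≡ ((b ∷ []) ^ (k ∸ 2)) ++ (a ∷ a ∷ b ∷ []) ++ ((a ∷ []) ^ (2 * k ∸ 6)))
  × (β (b ∷ a ∷ []) (W k)
       ≡ ((a ∷ []) ^ (k ∸ 5)) ++ (b ∷ b ∷ b ∷ b ∷ a ∷ []) ++ ((b ∷ []) ^ (k ∸ 5))
          ++ (a ∷ []) ++ ((b ∷ []) ^ (k ∸ 2)) ++ (a ∷ []))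
  × ((j : ℕ) → 2 ≤ j → j ≤ k ∸ 1 →
       β (((b ∷ []) ^ j) ++ (a ∷ [])) (W k)
         ≡ (b ∷ a ∷ []) ++ ((b ∷ []) ^ (2 * k ∸ 2 * j ∸ 2)) ++ (a ∷ []))
  × (β (((b ∷ []) ^ k) ++ (a ∷ [])) (W k) ≡ (a ∷ []))
  × (BWT (W k)
       ≡ prod 2 (k ∸ 1) (λ i → β (((a ∷ []) ^ (k ∸ i)) ++ (b ∷ [])) (W k))
         ++ prod 1 k (λ i → β (((b ∷ []) ^ i) ++ (a ∷ [])) (W k)))
  × (r (W k) ≡ 8 * k ∸ 20)

lemma18 k 5<k with m≤n⇒∃[o]m+o≡n 5<k
... | n , refl =
  Wₖ.β-aⁱb n , Wₖ.β-a³b n , Wₖ.β-a²b n , Wₖ.β-ab n , Wₖ.β-ba n , Wₖ.β-bʲa n , Wₖ.β-bᵏa n ,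
  Wₖ.BWT-W n , Wₖ.r-W n
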